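{- Let $\Phi=\{4321,\,34512,\,45123,\,35412,\,43512,\,45132,\,45213,\,53412,\,45312,\,45231\}$. For any permutation $w$, $$[321;3412](w)-\mathrm{rep}(w)\ \ge\ \bigl|\{r:\ w \text{ has an } r\text{ -occurrence of some pattern in }\Phi\}\bigr|.$$
   Context: Permutations $w\in\mathfrak{S}_n$ are written in one-line notation $w(1)\cdots w(n)$; $s_i$ is the simple reflection interchanging $i$ and $i+1$. The length $\ell(w)$ is the minimal number of simple reflections whose product is $w$ (such a minimal product is a reduced decomposition). The support $\mathrm{supp}(w)$ is the set of distinct simple reflections appearing in a reduced decomposition of $w$ (independent of the choice). $\mathrm{rep}(w)=\ell(w)-|\mathrm{supp}(w)|$. For $p\in\mathfrak{S}_k$, an occurrence of $p$ in $w$ is a subsequence $w(i_1)\cdots w(i_k)$, $i_1<\cdots<i_k$, in the same relative order as $p(1)\cdots p(k)$; it is an $r$-occurrence if $\max\{w(i_1),\dots,w(i_k)\}=r$. $[321;3412](w)$ is the number of occurrences of $321$ in $w$ plus the number of occurrences of $3412$ in $w$. -}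

module Defs where

open import Data.Nat using (ℕ; zero; suc; _+_; _∸_; _≤_; _<ᵇ_; _≡ᵇ_; _⊔_)
open import Data.Bool using (Bool; true; false; _∧_; _∨_; if_then_else_)
open import Data.Bool.Properties using () renaming (_≟_ to _≟B_)
open import Data.Fin using (Fin; toℕ; inject₁) renaming (suc to fsuc)
import Data.Fin as F
open import Data.List using (List; []; _∷_; _++_; map; length; filterᵇ; deduplicate)
open import Data.Bool.ListAction using (any)
open import Data.List using (allFin) public
open import Data.Fin.Permutation using (Permutation′; _⟨$⟩ʳ_) public
open import Data.Product using (_×_)
open import Relation.Binary.PropositionalEquality using (_≡_)
open import Relation.Nullary using (does)

_==B_ : Bool → Bool → Bool
a ==B b = does (a ≟B b)

-- All subsequences of a list (order preserved; each index choice once).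
-- Applied to allFin n, this enumerates all index tuples i₁ < ⋯ < i_k.
subseqs : {A : Set} → List A → List (List A)
subseqs [] = [] ∷ []
subseqs (x ∷ xs) = map (x ∷_) (subseqs xs) ++ subseqs xs

sameRel : ℕ → List ℕ → ℕ → List ℕ → Bool
sameRel x [] y [] = true
sameRel x (x' ∷ xs) y (y' ∷ ys) = ((x <ᵇ x') ==B (y <ᵇ y')) ∧ sameRel x xs y ys
sameRel _ _ _ _ = false

sameOrder : List ℕ → List ℕ → Bool
sameOrder [] [] = true
sameOrder (x ∷ xs) (y ∷ ys) = sameRel x xs y ys ∧ sameOrder xs ys
sameOrder _ _ = false

valuesAt : {n : ℕ} → Permutation′ n → List (Fin n) → List ℕ
valuesAt w is = map (λ i → toℕ (w ⟨$⟩ʳ i)) is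

occurrences : {n : ℕ} → Permutation′ n → List ℕ → List (List (Fin n))
occurrences {n} w p = filterᵇ (λ is → sameOrder p (valuesAt w is)) (subseqs (allFin n))

count : {n : ℕ} → Permutation′ n → List ℕ → ℕ
count w p = length (occurrences w p)

count321-3412 : {n : ℕ} → Permutation′ n → ℕ
count321-3412 w = count w (3 ∷ 2 ∷ 1 ∷ []) + count w (3 ∷ 4 ∷ 1 ∷ 2 ∷ [])

maxList : List ℕ → ℕ
maxList [] = 0
maxList (x ∷ xs) = x ⊔ maxList xs

-- w has an r-occurrence of p  (r given as a value of w, 0-based: value toℕ r)
hasROcc : {n : ℕ} → Permutation′ n → List ℕ → Fin n → Bool
hasROcc w p r = any (λ is → maxList (valuesAt w is) ≡ᵇ toℕ r) (occurrences w p)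

Φ : List (List ℕ)
Φ = (4 ∷ 3 ∷ 2 ∷ 1 ∷ [])
  ∷ (3 ∷ 4 ∷ 5 ∷ 1 ∷ 2 ∷ [])
  ∷ (4 ∷ 5 ∷ 1 ∷ 2 ∷ 3 ∷ [])
  ∷ (3 ∷ 5 ∷ 4 ∷ 1 ∷ 2 ∷ [])
  ∷ (4 ∷ 3 ∷ 5 ∷ 1 ∷ 2 ∷ [])
  ∷ (4 ∷ 5 ∷ 1 ∷ 3 ∷ 2 ∷ [])
  ∷ (4 ∷ 5 ∷ 2 ∷ 1 ∷ 3 ∷ [])
  ∷ (5 ∷ 3 ∷ 4 ∷ 1 ∷ 2 ∷ [])
  ∷ (4 ∷ 5 ∷ 3 ∷ 1 ∷ 2 ∷ [])
  ∷ (4 ∷ 5 ∷ 2 ∷ 3 ∷ 1 ∷ [])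
  ∷ []

ΦValues : {n : ℕ} → Permutation′ n → List (Fin n)
ΦValues {n} w = filterᵇ (λ r → any (λ p → hasROcc w p r) Φ) (allFin n)

-- Simple reflections of S_{m+1} (acting on Fin (suc m)): s_i, i : Fin m,
-- interchanges positions/values inject₁ i and suc i (i.e. i+1 and i+2 1-based).
sref : {m : ℕ} → Fin m → Fin (suc m) → Fin (suc m)
sref i x = if does (x F.≟ inject₁ i) then fsuc i
           else if does (x F.≟ fsuc i) then inject₁ i else x

wordFun : {m : ℕ} → List (Fin m) → Fin (suc m) → Fin (suc m)
wordFun [] x = x
wordFun (i ∷ ρ) x = sref i (wordFun ρ x)

IsWordFor : {m : ℕ} → Permutation′ (suc m) → List (Fin m) → Set
IsWordFor w ρ = ∀ x → wordFun ρ x ≡ w ⟨$⟩ʳ x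

IsReduced : {m : ℕ} → Permutation′ (suc m) → List (Fin m) → Set
IsReduced w ρ = IsWordFor w ρ × (∀ ρ' → IsWordFor w ρ' → length ρ ≤ length ρ')

supp : {m : ℕ} → List (Fin m) → List (Fin m)
supp ρ = deduplicate F._≟_ ρ

-- rep(w) = ℓ(w) − |supp(w)| computed from a reduced decomposition ρ
rep : {m : ℕ} → List (Fin m) → ℕ
rep ρ = length ρ ∸ length (supp ρ)

-- Build the one-line notation of w (values 0, …, n − 1) by inserting its values in increasing
-- order, so that each new value n is the current maximum, placed between two blocks xs and ys.
-- Call a cut of the one-line notation a crossing when some value on its left exceeds some value
-- on its right. A word avoiding s_j fixes {0, …, j} setwise, so the crossings number at most
-- |supp(w)|, and the bubble-sort word gives ℓ(w) ≤ inv(w); it therefore suffices to prove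
--   inv(w) + #{Φ-values of w} ≤ [321;3412](w) + #{crossings of w}.
-- Inserting n adds |ys| to inv, adds the inversions of ys and the 312-occurrences a·t (a in xs,
-- t in ys) to [321;3412], and adds |ys| minus the crossings at the cuts inside ys (relative to xs)
-- to the crossings. So one must bound those crossings, plus one if n is a Φ-value, by the new
-- occurrences. Appending the entries y of ys one by one, y creates at most
-- #{b in ys, b > y} + #{a in xs, a > y}·#{b in ys, b < y} new crossings, exactly the number of
-- new occurrences; and an occurrence of a pattern of Φ with maximum n leaves, once n is deleted,
-- one of five configurations (Slack) in which this bound is strict.

module Submission where

open import Defs
open import Data.Nat using (ℕ; suc; _+_; _≤_)
open import Data.List using (List; length)
open import Data.Fin using (Fin)
open import Function using (_∘_; id)
open import Data.Nat using (zero; _*_; _∸_; _<_; _<ᵇ_; _≡ᵇ_; z≤n; s≤s)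
open import Data.Nat.Properties
open import Algebra.Properties.CommutativeSemigroup +-commutativeSemigroup using (interchange)
open import Data.Nat.Solver using (module +-*-Solver)
open +-*-Solver using (solve; _:+_; _:=_)
open import Data.Bool using (Bool; true; false; _∧_; _∨_; not; if_then_else_; T)
open import Data.Bool.Properties using (∨-assoc; ∧-zeroʳ)
open import Data.Bool.ListAction using (any)
open import Data.List using ([]; _∷_; _++_; map; filterᵇ; tabulate; applyUpTo; upTo; _∷ʳ_)
open import Data.List.Properties
  using (++-assoc; ++-identityʳ; ∷ʳ-injective; length-++; length-upTo; upTo-∷ʳ; map-++; map-∘; map-cong; map-tabulate;
         length-tabulate; length-map; length-deduplicate)
open import Data.List.Reverse using (Reverse; reverseView; []; _∶_∶ʳ_)
open import Data.List.Membership.Propositional using (_∈_)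
open import Data.List.Membership.Propositional.Properties
  using (∈-++⁺ˡ; ∈-++⁺ʳ; ∈-++⁻; ∈-map⁺; ∈-map⁻; ∈-∃++; ∈-upTo⁺; ∈-upTo⁻; ∈-deduplicate⁺; ∈-tabulate⁻)
open import Data.List.Membership.DecPropositional _≟_ using (_∈?_)
open import Data.List.Relation.Unary.Any using (here; there)
open import Data.List.Relation.Unary.All using (All; []; _∷_; lookup)
open import Data.List.Relation.Unary.AllPairs using (AllPairs; []; _∷_)
open import Data.List.Relation.Unary.AllPairs.Properties using (applyUpTo⁺₁)
open import Data.Fin using (toℕ; inject₁; fromℕ<) renaming (zero to fzero; suc to fsuc)
import Data.Fin as Fin
open import Data.Fin.Properties using (toℕ-injective; toℕ<n; toℕ-fromℕ<; toℕ-inject₁)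
  renaming (suc-injective to fsuc-injective; 0≢1+n to fzero≢fsuc)
open import Data.Fin.Permutation using (_⟨$⟩ˡ_; inverseˡ)
open import Data.Product using (Σ; _×_; _,_; proj₁; proj₂)
open import Data.Sum using (_⊎_; inj₁; inj₂)
open import Data.Unit using (⊤; tt)
open import Data.Empty using (⊥; ⊥-elim)
open import Relation.Binary using (tri<; tri≈; tri>)
open import Relation.Binary.PropositionalEquality
open import Relation.Nullary using (¬_; does; yes; no)

χ : Bool → ℕ
χ true = 1
χ false = 0

χ-mono : ∀ a b → (a ≡ true → b ≡ true) → χ a ≤ χ b
χ-mono false b h = z≤n
χ-mono true b h rewrite h refl = ≤-refl

χ≤1 : ∀ b → χ b ≤ 1
χ≤1 true = ≤-refl
χ≤1 false = z≤n

∑ : {A : Set} → (A → ℕ) → List A → ℕ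
∑ f [] = 0
∑ f (x ∷ xs) = f x + ∑ f xs

countᵇ : {A : Set} → (A → Bool) → List A → ℕ
countᵇ p = ∑ (λ x → χ (p x))

module _ {A : Set} (f : A → ℕ) where

  ∑-++ : ∀ xs ys → ∑ f (xs ++ ys) ≡ ∑ f xs + ∑ f ys
  ∑-++ [] ys = refl
  ∑-++ (x ∷ xs) ys = trans (cong (f x +_) (∑-++ xs ys)) (sym (+-assoc (f x) _ _))

  ∑-zero : ∀ xs → (∀ x → x ∈ xs → f x ≡ 0) → ∑ f xs ≡ 0
  ∑-zero [] h = refl
  ∑-zero (x ∷ xs) h rewrite h x (here refl) = ∑-zero xs (λ z z∈ → h z (there z∈))

  ∑-cong : ∀ (g : A → ℕ) xs → (∀ x → x ∈ xs → f x ≡ g x) → ∑ f xs ≡ ∑ g xs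
  ∑-cong g [] h = refl
  ∑-cong g (x ∷ xs) h = cong₂ _+_ (h x (here refl)) (∑-cong g xs (λ z z∈ → h z (there z∈)))

∑-one : {A : Set} (xs : List A) → ∑ (λ _ → 1) xs ≡ length xs
∑-one [] = refl
∑-one (x ∷ xs) = cong suc (∑-one xs)

∑-map : {A B : Set} (f : B → ℕ) (g : A → B) (xs : List A) → ∑ f (map g xs) ≡ ∑ (λ x → f (g x)) xs
∑-map f g [] = refl
∑-map f g (x ∷ xs) = cong (f (g x) +_) (∑-map f g xs)

module _ {A : Set} (p : A → Bool) where

  length-filterᵇ : ∀ xs → length (filterᵇ p xs) ≡ countᵇ p xs
  length-filterᵇ [] = refl
  length-filterᵇ (x ∷ xs) with p x
  ... | true = cong suc (length-filterᵇ xs)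
  ... | false = length-filterᵇ xs

  countᵇ-zero : ∀ xs → (∀ x → x ∈ xs → p x ≡ false) → countᵇ p xs ≡ 0
  countᵇ-zero xs h = ∑-zero _ xs (λ x x∈ → cong χ (h x x∈))

  countᵇ-pos : ∀ {x xs} → x ∈ xs → p x ≡ true → 1 ≤ countᵇ p xs
  countᵇ-pos {xs = y ∷ xs} (here refl) e rewrite e = s≤s z≤n
  countᵇ-pos {xs = y ∷ xs} (there x∈) e = ≤-trans (countᵇ-pos x∈ e) (m≤n+m _ (χ (p y)))

  any-intro : ∀ {x xs} → x ∈ xs → p x ≡ true → any p xs ≡ true
  any-intro {xs = y ∷ xs} (here refl) h rewrite h = refl
  any-intro {xs = y ∷ xs} (there x∈) h with p y
  ... | true = refl
  ... | false = any-intro x∈ h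

  any-elim : ∀ xs → any p xs ≡ true → Σ A (λ x → x ∈ xs × p x ≡ true)
  any-elim (y ∷ xs) h with p y in eq
  ... | true = y , here refl , eq
  ... | false with any-elim xs h
  ... | x , x∈ , px = x , there x∈ , px

  any-false : ∀ xs → any p xs ≡ false → ∀ x → x ∈ xs → p x ≡ false
  any-false (y ∷ xs) h x (here refl) with p x
  ... | true = h
  ... | false = refl
  any-false (y ∷ xs) h x (there x∈) with p y
  any-false (y ∷ xs) () x (there x∈) | true
  ... | false = any-false xs h x x∈

  any-++ : ∀ xs ys → any p (xs ++ ys) ≡ (any p xs ∨ any p ys)
  any-++ [] ys = refl
  any-++ (x ∷ xs) ys rewrite any-++ xs ys = sym (∨-assoc (p x) (any p xs) (any p ys))

any-map : {A B : Set} (q : B → Bool) (f : A → B) (xs : List A) → any q (map f xs) ≡ any (λ x → q (f x)) xs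
any-map q f [] = refl
any-map q f (x ∷ xs) = cong (q (f x) ∨_) (any-map q f xs)

module _ {A : Set} (p q : A → Bool) where

  countᵇ-cong : ∀ xs → (∀ x → x ∈ xs → p x ≡ q x) → countᵇ p xs ≡ countᵇ q xs
  countᵇ-cong xs h = ∑-cong _ _ xs (λ x x∈ → cong χ (h x x∈))

  countᵇ-mono : ∀ xs → (∀ x → x ∈ xs → p x ≡ true → q x ≡ true) → countᵇ p xs ≤ countᵇ q xs
  countᵇ-mono [] h = z≤n
  countᵇ-mono (x ∷ xs) h = +-mono-≤ (χ-mono (p x) (q x) (h x (here refl))) (countᵇ-mono xs (λ z z∈ → h z (there z∈)))

  any-cong : ∀ xs → (∀ x → p x ≡ q x) → any p xs ≡ any q xs
  any-cong [] h = refl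
  any-cong (x ∷ xs) h = cong₂ _∨_ (h x) (any-cong xs h)

<ᵇ≡true⇒< : ∀ m n → (m <ᵇ n) ≡ true → m < n
<ᵇ≡true⇒< m n h = <ᵇ⇒< m n (subst T (sym h) _)

<⇒<ᵇ≡true : ∀ {m n} → m < n → (m <ᵇ n) ≡ true
<⇒<ᵇ≡true {m} {n} h with m <ᵇ n in eq
... | true = refl
... | false = ⊥-elim (subst T eq (<⇒<ᵇ h))

<ᵇ≡false⇒≥ : ∀ m n → (m <ᵇ n) ≡ false → n ≤ m
<ᵇ≡false⇒≥ m n h with m <? n
... | yes m<n with () ← trans (sym (<⇒<ᵇ≡true m<n)) h
... | no m≮n = ≮⇒≥ m≮n

≥⇒<ᵇ≡false : ∀ {m n} → n ≤ m → (m <ᵇ n) ≡ false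
≥⇒<ᵇ≡false {m} {n} h with m <ᵇ n in eq
... | false = refl
... | true = ⊥-elim (<⇒≱ (<ᵇ≡true⇒< m n eq) h)

≡ᵇ≡true⇒≡ : ∀ m n → (m ≡ᵇ n) ≡ true → m ≡ n
≡ᵇ≡true⇒≡ m n h = ≡ᵇ⇒≡ m n (subst T (sym h) _)

≡ᵇ-refl : ∀ m → (m ≡ᵇ m) ≡ true
≡ᵇ-refl zero = refl
≡ᵇ-refl (suc m) = ≡ᵇ-refl m

≢⇒≡ᵇ≡false : ∀ {m n} → m ≢ n → (m ≡ᵇ n) ≡ false
≢⇒≡ᵇ≡false {m} {n} ne with m ≡ᵇ n in eq
... | false = refl
... | true = ⊥-elim (ne (≡ᵇ≡true⇒≡ m n eq))

≢⇒<⊎> : ∀ {m n} → m ≢ n → m < n ⊎ n < m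
≢⇒<⊎> {m} {n} ne with <-cmp m n
... | tri< m<n _ _ = inj₁ m<n
... | tri≈ _ m≡n _ = ⊥-elim (ne m≡n)
... | tri> _ _ n<m = inj₂ n<m

∧-true : ∀ {a b} → (a ∧ b) ≡ true → (a ≡ true) × (b ≡ true)
∧-true {true} {true} e = refl , refl

≢true⇒≡false : ∀ {a : Bool} → ¬ (a ≡ true) → a ≡ false
≢true⇒≡false {true} f = ⊥-elim (f refl)
≢true⇒≡false {false} f = refl

bool-ext : ∀ {a b : Bool} → (a ≡ true → b ≡ true) → (b ≡ true → a ≡ true) → a ≡ b
bool-ext {true} {true} f g = refl
bool-ext {false} {false} f g = refl
bool-ext {true} {false} f g = sym (f refl)
bool-ext {false} {true} f g = g refl

infix 4 _⊑_
data _⊑_ {A : Set} : List A → List A → Set where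
  done : [] ⊑ []
  skip : ∀ {xs ys} y → xs ⊑ ys → xs ⊑ (y ∷ ys)
  keep : ∀ {xs ys} x → xs ⊑ ys → (x ∷ xs) ⊑ (x ∷ ys)

module _ {A : Set} where

  []⊑ : ∀ (xs : List A) → [] ⊑ xs
  []⊑ [] = done
  []⊑ (x ∷ xs) = skip x ([]⊑ xs)

  ⊑-refl : ∀ (xs : List A) → xs ⊑ xs
  ⊑-refl [] = done
  ⊑-refl (x ∷ xs) = keep x (⊑-refl xs)

  ⊑-trans : ∀ {xs ys zs : List A} → xs ⊑ ys → ys ⊑ zs → xs ⊑ zs
  ⊑-trans p done = p
  ⊑-trans p (skip y q) = skip y (⊑-trans p q)
  ⊑-trans (skip _ p) (keep x q) = skip x (⊑-trans p q)
  ⊑-trans (keep _ p) (keep x q) = keep x (⊑-trans p q)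

  ∈-resp-⊑ : ∀ {x : A} {xs ys} → x ∈ xs → xs ⊑ ys → x ∈ ys
  ∈-resp-⊑ x∈ (skip y q) = there (∈-resp-⊑ x∈ q)
  ∈-resp-⊑ (here refl) (keep x q) = here refl
  ∈-resp-⊑ (there x∈) (keep x q) = there (∈-resp-⊑ x∈ q)

  ⊑-++ : ∀ {xs xs' ys ys' : List A} → xs ⊑ xs' → ys ⊑ ys' → (xs ++ ys) ⊑ (xs' ++ ys')
  ⊑-++ done q = q
  ⊑-++ (skip y p) q = skip y (⊑-++ p q)
  ⊑-++ (keep x p) q = keep x (⊑-++ p q)

  ⊑-++ˡ : ∀ (xs ys : List A) → xs ⊑ (xs ++ ys)
  ⊑-++ˡ xs ys = subst (_⊑ (xs ++ ys)) (++-identityʳ xs) (⊑-++ (⊑-refl xs) ([]⊑ ys))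

  ∷ʳ⋢[] : ∀ (xs : List A) y → ¬ (xs ∷ʳ y) ⊑ []
  ∷ʳ⋢[] [] y ()
  ∷ʳ⋢[] (x ∷ xs) y ()

  ⊑-countᵇ : ∀ (p : A → Bool) {xs ys} → xs ⊑ ys → countᵇ p xs ≤ countᵇ p ys
  ⊑-countᵇ p done = z≤n
  ⊑-countᵇ p (skip y q) = ≤-trans (⊑-countᵇ p q) (m≤n+m _ (χ (p y)))
  ⊑-countᵇ p (keep x q) = +-monoʳ-≤ (χ (p x)) (⊑-countᵇ p q)

  ⊑⇒∈subseqs : ∀ {xs ys : List A} → xs ⊑ ys → xs ∈ subseqs ys
  ⊑⇒∈subseqs done = here refl
  ⊑⇒∈subseqs {ys = y ∷ ys} (skip y q) = ∈-++⁺ʳ (map (y ∷_) (subseqs ys)) (⊑⇒∈subseqs q)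
  ⊑⇒∈subseqs (keep x q) = ∈-++⁺ˡ (∈-map⁺ (x ∷_) (⊑⇒∈subseqs q))

  ∈subseqs⇒⊑ : ∀ {xs : List A} ys → xs ∈ subseqs ys → xs ⊑ ys
  ∈subseqs⇒⊑ [] (here refl) = done
  ∈subseqs⇒⊑ (y ∷ ys) h with ∈-++⁻ (map (y ∷_) (subseqs ys)) h
  ... | inj₂ h' = skip y (∈subseqs⇒⊑ ys h')
  ... | inj₁ h' with ∈-map⁻ (y ∷_) h'
  ... | t , t∈ , refl = keep y (∈subseqs⇒⊑ ys t∈)

  ⊑-∷ʳ⁻ : ∀ {xs} ys (y : A) → xs ⊑ (ys ∷ʳ y) → xs ⊑ ys ⊎ Σ (List A) λ xs' → xs ≡ xs' ∷ʳ y × xs' ⊑ ys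
  ⊑-∷ʳ⁻ [] y (skip y q) = inj₁ q
  ⊑-∷ʳ⁻ [] y (keep y done) = inj₂ ([] , refl , done)
  ⊑-∷ʳ⁻ (b ∷ ys) y (skip b q) with ⊑-∷ʳ⁻ ys y q
  ... | inj₁ r = inj₁ (skip b r)
  ... | inj₂ (xs' , refl , r) = inj₂ (xs' , refl , skip b r)
  ⊑-∷ʳ⁻ (b ∷ ys) y (keep b q) with ⊑-∷ʳ⁻ ys y q
  ... | inj₁ r = inj₁ (keep b r)
  ... | inj₂ (xs' , refl , r) = inj₂ (b ∷ xs' , refl , keep b r)

  ⊑-remove : ∀ {xs} ys (z : A) zs → xs ⊑ (ys ++ z ∷ zs) → ¬ (z ∈ xs) → xs ⊑ (ys ++ zs)
  ⊑-remove [] z zs (skip z q) z∉ = q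
  ⊑-remove [] z zs (keep z q) z∉ = ⊥-elim (z∉ (here refl))
  ⊑-remove (y ∷ ys) z zs (skip y q) z∉ = skip y (⊑-remove ys z zs q z∉)
  ⊑-remove (y ∷ ys) z zs (keep y q) z∉ = keep y (⊑-remove ys z zs q (λ z∈ → z∉ (there z∈)))

  ⊑-split : ∀ pre post ys (z : A) zs → (pre ++ z ∷ post) ⊑ (ys ++ z ∷ zs) →
            ¬ (z ∈ ys) → ¬ (z ∈ zs) → ¬ (z ∈ pre) → pre ⊑ ys × post ⊑ zs
  ⊑-split [] post [] z zs (skip z q) _ z∉zs _ = ⊥-elim (z∉zs (∈-resp-⊑ (here refl) q))
  ⊑-split [] post [] z zs (keep z q) _ _ _ = done , q
  ⊑-split (x ∷ pre) post [] z zs (skip z q) _ z∉zs _ = ⊥-elim (z∉zs (∈-resp-⊑ (∈-++⁺ʳ (x ∷ pre) (here refl)) q))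
  ⊑-split (x ∷ pre) post [] z zs (keep z q) _ _ z∉pre = ⊥-elim (z∉pre (here refl))
  ⊑-split pre post (y ∷ ys) z zs (skip y q) z∉ys z∉zs z∉pre
    with r , r' ← ⊑-split pre post ys z zs q (λ z∈ → z∉ys (there z∈)) z∉zs z∉pre = skip y r , r'
  ⊑-split [] post (y ∷ ys) z zs (keep y q) z∉ys _ _ = ⊥-elim (z∉ys (here refl))
  ⊑-split (x ∷ pre) post (x ∷ ys) z zs (keep x q) z∉ys z∉zs z∉pre
    with r , r' ← ⊑-split pre post ys z zs q (λ z∈ → z∉ys (there z∈)) z∉zs (λ z∈ → z∉pre (there z∈)) = keep x r , r'

data Distinct {A : Set} : List A → Set where
  [] : Distinct []
  _∷_ : ∀ {x xs} → ¬ (x ∈ xs) → Distinct xs → Distinct (x ∷ xs)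

module _ {A : Set} where

  Distinct-resp-⊑ : ∀ {xs ys : List A} → xs ⊑ ys → Distinct ys → Distinct xs
  Distinct-resp-⊑ done d = d
  Distinct-resp-⊑ (skip y q) (_ ∷ d) = Distinct-resp-⊑ q d
  Distinct-resp-⊑ (keep x q) (x∉ ∷ d) = (λ x∈ → x∉ (∈-resp-⊑ x∈ q)) ∷ Distinct-resp-⊑ q d

  Distinct-∷ʳ⁻ : ∀ xs (y : A) → Distinct (xs ∷ʳ y) → ¬ (y ∈ xs)
  Distinct-∷ʳ⁻ (x ∷ xs) y (x∉ ∷ d) (here refl) = x∉ (∈-++⁺ʳ xs (here refl))
  Distinct-∷ʳ⁻ (x ∷ xs) y (x∉ ∷ d) (there y∈) = Distinct-∷ʳ⁻ xs y d y∈

  Distinct-middle : ∀ xs (z : A) ys → Distinct (xs ++ z ∷ ys) → ¬ (z ∈ xs) × ¬ (z ∈ ys) × Distinct (xs ++ ys)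
  Distinct-middle xs z ys d = z∉xs xs d , z∉ys , Distinct-resp-⊑ (⊑-++ (⊑-refl xs) (skip z (⊑-refl ys))) d
    where
      z∉xs : ∀ xs' → Distinct (xs' ++ z ∷ ys) → ¬ (z ∈ xs')
      z∉xs (x ∷ xs') (x∉ ∷ d') (here refl) = x∉ (∈-++⁺ʳ xs' (here refl))
      z∉xs (x ∷ xs') (x∉ ∷ d') (there z∈) = z∉xs xs' d' z∈
      z∉ys : ¬ (z ∈ ys)
      z∉ys z∈ with z∉ ∷ _ ← Distinct-resp-⊑ (⊑-++ ([]⊑ xs) (⊑-refl (z ∷ ys))) d = z∉ z∈

  Distinct-∷ʳ-split : ∀ xs ys (y : A) → Distinct (xs ++ ys ∷ʳ y) → ¬ (y ∈ xs) × ¬ (y ∈ ys) × Distinct (xs ++ ys)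
  Distinct-∷ʳ-split xs ys y d with d' ← subst Distinct (sym (++-assoc xs ys (y ∷ []))) d =
    (λ y∈ → Distinct-∷ʳ⁻ (xs ++ ys) y d' (∈-++⁺ˡ y∈)) ,
    (λ y∈ → Distinct-∷ʳ⁻ (xs ++ ys) y d' (∈-++⁺ʳ xs y∈)) ,
    Distinct-resp-⊑ (⊑-++ˡ (xs ++ ys) (y ∷ [])) d'

  length-++-∷ : ∀ (xs : List A) z ys → length (xs ++ z ∷ ys) ≡ suc (length (xs ++ ys))
  length-++-∷ [] z ys = refl
  length-++-∷ (x ∷ xs) z ys = cong suc (length-++-∷ xs z ys)

  Distinct⇒countᵇ-≤ : ∀ (p : A → Bool) {xs ys : List A} → Distinct xs → (∀ x → x ∈ xs → p x ≡ true → x ∈ ys) →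
                     countᵇ p xs ≤ length ys
  Distinct⇒countᵇ-≤ p [] h = z≤n
  Distinct⇒countᵇ-≤ p {x ∷ xs} {ys} (x∉ ∷ d) h with p x in e
  ... | false = Distinct⇒countᵇ-≤ p d (λ z z∈ → h z (there z∈))
  ... | true with ys₁ , ys₂ , refl ← ∈-∃++ (h x (here refl) e) =
    subst (suc (countᵇ p xs) ≤_) (sym (length-++-∷ ys₁ x ys₂)) (s≤s (Distinct⇒countᵇ-≤ p d h'))
    where
      h' : ∀ z → z ∈ xs → p z ≡ true → z ∈ (ys₁ ++ ys₂)
      h' z z∈ pz with ∈-++⁻ ys₁ (h z (there z∈) pz)
      ... | inj₁ z∈₁ = ∈-++⁺ˡ z∈₁
      ... | inj₂ (here refl) = ⊥-elim (x∉ z∈)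
      ... | inj₂ (there z∈₂) = ∈-++⁺ʳ ys₁ z∈₂

-- Order patterns and sums over subsequences

SameRel : ℕ → List ℕ → ℕ → List ℕ → Set
SameRel x [] y [] = ⊤
SameRel x (x' ∷ xs) y (y' ∷ ys) = (x <ᵇ x') ≡ (y <ᵇ y') × SameRel x xs y ys
SameRel x [] y (_ ∷ _) = ⊥
SameRel x (_ ∷ _) y [] = ⊥

SameOrder : List ℕ → List ℕ → Set
SameOrder [] [] = ⊤
SameOrder (x ∷ xs) (y ∷ ys) = SameRel x xs y ys × SameOrder xs ys
SameOrder [] (_ ∷ _) = ⊥
SameOrder (_ ∷ _) [] = ⊥

==B⇒≡ : ∀ a b → (a ==B b) ≡ true → a ≡ b
==B⇒≡ true true e = refl
==B⇒≡ false false e = refl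

==B-refl : ∀ a → (a ==B a) ≡ true
==B-refl true = refl
==B-refl false = refl

sameRel⇒SameRel : ∀ x xs y ys → sameRel x xs y ys ≡ true → SameRel x xs y ys
sameRel⇒SameRel x [] y [] e = tt
sameRel⇒SameRel x (x' ∷ xs) y (y' ∷ ys) e with e₁ , e₂ ← ∧-true {(x <ᵇ x') ==B (y <ᵇ y')} e =
  ==B⇒≡ _ _ e₁ , sameRel⇒SameRel x xs y ys e₂

SameRel⇒sameRel : ∀ x xs y ys → SameRel x xs y ys → sameRel x xs y ys ≡ true
SameRel⇒sameRel x [] y [] r = refl
SameRel⇒sameRel x (x' ∷ xs) y (y' ∷ ys) (r , rs) rewrite r | ==B-refl (y <ᵇ y') = SameRel⇒sameRel x xs y ys rs

sameOrder⇒SameOrder : ∀ p s → sameOrder p s ≡ true → SameOrder p s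
sameOrder⇒SameOrder [] [] e = tt
sameOrder⇒SameOrder (x ∷ xs) (y ∷ ys) e with e₁ , e₂ ← ∧-true {sameRel x xs y ys} e =
  sameRel⇒SameRel x xs y ys e₁ , sameOrder⇒SameOrder xs ys e₂

SameOrder⇒sameOrder : ∀ p s → SameOrder p s → sameOrder p s ≡ true
SameOrder⇒sameOrder [] [] o = refl
SameOrder⇒sameOrder (x ∷ xs) (y ∷ ys) (r , o) rewrite SameRel⇒sameRel x xs y ys r = SameOrder⇒sameOrder xs ys o

¬SameRel-[]-∷ʳ : ∀ x y s z → ¬ SameRel x [] y (s ∷ʳ z)
¬SameRel-[]-∷ʳ x y [] z ()
¬SameRel-[]-∷ʳ x y (_ ∷ s) z ()

SameRel-below : ∀ x xs y ys → SameRel x xs y ys → (∀ x' → x' ∈ xs → x' ≤ x) → ∀ y' → y' ∈ ys → y' ≤ y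
SameRel-below x (x' ∷ xs) y (y' ∷ ys) (r , _) h y' (here refl) =
  <ᵇ≡false⇒≥ y y' (trans (sym r) (≥⇒<ᵇ≡false (h x' (here refl))))
SameRel-below x (x' ∷ xs) y (_ ∷ ys) (_ , rs) h y' (there y'∈) = SameRel-below x xs y ys rs (λ z z∈ → h z (there z∈)) y' y'∈

∑-subseqs-∷ : {A : Set} (f : List A → ℕ) → ∀ x xs →
              ∑ f (subseqs (x ∷ xs)) ≡ ∑ (λ s → f (x ∷ s)) (subseqs xs) + ∑ f (subseqs xs)
∑-subseqs-∷ f x xs = trans (∑-++ f (map (x ∷_) (subseqs xs)) (subseqs xs))
                           (cong (_+ ∑ f (subseqs xs)) (∑-map f (x ∷_) (subseqs xs)))

∑-subseqs-[] : {A : Set} (f : List A → ℕ) → ∀ xs → (∀ x s → (x ∷ s) ⊑ xs → f (x ∷ s) ≡ 0) →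
               ∑ f (subseqs xs) ≡ f []
∑-subseqs-[] f [] h = +-identityʳ (f [])
∑-subseqs-[] f (x ∷ xs) h rewrite ∑-subseqs-∷ f x xs
  | ∑-zero (λ s → f (x ∷ s)) (subseqs xs) (λ s s∈ → h x s (keep x (∈subseqs⇒⊑ xs s∈)))
  = ∑-subseqs-[] f xs (λ c s q → h c s (skip x q))

∑-subseqs-singletons : {A : Set} (f : List A → ℕ) → ∀ xs → f [] ≡ 0 →
                       (∀ x x' s → (x ∷ x' ∷ s) ⊑ xs → f (x ∷ x' ∷ s) ≡ 0) →
                       ∑ f (subseqs xs) ≡ ∑ (λ x → f (x ∷ [])) xs
∑-subseqs-singletons f [] h₀ h = trans (+-identityʳ (f [])) h₀
∑-subseqs-singletons f (x ∷ xs) h₀ h rewrite ∑-subseqs-∷ f x xs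
  | ∑-subseqs-[] (λ s → f (x ∷ s)) xs (λ x' s q → h x x' s (keep x q))
  = cong (f (x ∷ []) +_) (∑-subseqs-singletons f xs h₀ (λ c d s q → h c d s (skip x q)))

∑-subseqs-∷ʳ : {A : Set} (f : List A → ℕ) → ∀ xs y →
               ∑ f (subseqs (xs ∷ʳ y)) ≡ ∑ f (subseqs xs) + ∑ (λ s → f (s ∷ʳ y)) (subseqs xs)
∑-subseqs-∷ʳ f [] y = trans (+-comm (f (y ∷ [])) (f [] + 0)) (cong (f [] + 0 +_) (sym (+-identityʳ _)))
∑-subseqs-∷ʳ f (x ∷ xs) y rewrite ∑-subseqs-∷ f x (xs ∷ʳ y) | ∑-subseqs-∷ f x xs
  | ∑-subseqs-∷ (λ s → f (s ∷ʳ y)) x xs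
  | ∑-subseqs-∷ʳ (λ s → f (x ∷ s)) xs y | ∑-subseqs-∷ʳ f xs y
  = interchange (∑ (λ s → f (x ∷ s)) (subseqs xs)) _ _ _

∑-subseqs-insert : {A : Set} (f : List A → ℕ) → ∀ xs z ys →
  ∑ f (subseqs (xs ++ z ∷ ys)) ≡
  ∑ f (subseqs (xs ++ ys)) + ∑ (λ s → ∑ (λ t → f (s ++ z ∷ t)) (subseqs ys)) (subseqs xs)
∑-subseqs-insert f [] z ys rewrite ∑-subseqs-∷ f z ys =
  trans (+-comm (∑ (λ t → f (z ∷ t)) (subseqs ys)) _) (cong (∑ f (subseqs ys) +_) (sym (+-identityʳ _)))
∑-subseqs-insert f (x ∷ xs) z ys rewrite ∑-subseqs-∷ f x (xs ++ z ∷ ys) | ∑-subseqs-∷ f x (xs ++ ys)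
  | ∑-subseqs-∷ (λ s → ∑ (λ t → f (s ++ z ∷ t)) (subseqs ys)) x xs
  | ∑-subseqs-insert (λ s → f (x ∷ s)) xs z ys | ∑-subseqs-insert f xs z ys
  = interchange (∑ (λ s → f (x ∷ s)) (subseqs (xs ++ ys))) _ _ _

#above : ℕ → List ℕ → ℕ
#above y = countᵇ (y <ᵇ_)

#below : ℕ → List ℕ → ℕ
#below y = countᵇ (_<ᵇ y)

countPattern : List ℕ → List ℕ → ℕ
countPattern p xs = countᵇ (sameOrder p) (subseqs xs)

inversions : List ℕ → ℕ
inversions = countPattern (2 ∷ 1 ∷ [])

occ312 : ℕ → List ℕ → ℕ
occ312 a xs = countᵇ (λ t → sameOrder (3 ∷ 1 ∷ 2 ∷ []) (a ∷ t)) (subseqs xs)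

occ312-across : List ℕ → List ℕ → ℕ
occ312-across xs ys = ∑ (λ a → occ312 a ys) xs

-- The occurrences of 321 and 3412 through a new maximum inserted between xs and ys.
occurrencesThroughMax : List ℕ → List ℕ → ℕ
occurrencesThroughMax xs ys = inversions ys + occ312-across xs ys

sameOrder-21 : ∀ {x y} → x ≢ y → sameOrder (2 ∷ 1 ∷ []) (x ∷ y ∷ []) ≡ (y <ᵇ x)
sameOrder-21 {x} {y} x≢y with ≢⇒<⊎> x≢y
... | inj₁ x<y rewrite ≥⇒<ᵇ≡false {y} {x} (<⇒≤ x<y) | <⇒<ᵇ≡true x<y = refl
... | inj₂ y<x rewrite <⇒<ᵇ≡true y<x | ≥⇒<ᵇ≡false {x} {y} (<⇒≤ y<x) = refl

sameOrder-312 : ∀ {a x y} → a ≢ y → sameOrder (3 ∷ 1 ∷ 2 ∷ []) (a ∷ x ∷ y ∷ []) ≡ (y <ᵇ a) ∧ (x <ᵇ y)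
sameOrder-312 {a} {x} {y} a≢y with ≢⇒<⊎> a≢y
... | inj₁ a<y rewrite <⇒<ᵇ≡true a<y | ≥⇒<ᵇ≡false {y} {a} (<⇒≤ a<y) = cong (_∧ _) (∧-zeroʳ (false ==B (a <ᵇ x)))
... | inj₂ y<a rewrite <⇒<ᵇ≡true y<a | ≥⇒<ᵇ≡false {a} {y} (<⇒≤ y<a) with x <ᵇ y in x<ᵇy
...   | false = ∧-zeroʳ _
...   | true rewrite ≥⇒<ᵇ≡false {a} {x} (<⇒≤ (<-trans (<ᵇ≡true⇒< x y x<ᵇy) y<a)) = refl

inversions-∷ʳ : ∀ xs y → ¬ (y ∈ xs) → inversions (xs ∷ʳ y) ≡ inversions xs + #above y xs
inversions-∷ʳ xs y y∉ = trans (∑-subseqs-∷ʳ _ xs y) (cong (inversions xs +_)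
  (trans (∑-subseqs-singletons _ xs refl (λ x x' s _ → cong χ (≢true⇒≡false λ e →
            ¬SameRel-[]-∷ʳ 2 x s y (proj₂ (proj₁ (sameOrder⇒SameOrder (2 ∷ 1 ∷ []) (x ∷ x' ∷ (s ∷ʳ y)) e))))))
         (∑-cong _ _ xs (λ x x∈ → cong χ (sameOrder-21 {x} {y} (λ { refl → y∉ x∈ }))))))

occ312-∷ʳ : ∀ a xs y → a ≢ y → occ312 a (xs ∷ʳ y) ≡ occ312 a xs + χ (y <ᵇ a) * #below y xs
occ312-∷ʳ a xs y a≢y = trans (∑-subseqs-∷ʳ _ xs y) (cong (occ312 a xs +_)
  (trans (∑-subseqs-singletons _ xs
            (cong χ (≢true⇒≡false λ e → proj₂ (proj₁ (sameOrder⇒SameOrder (3 ∷ 1 ∷ 2 ∷ []) (a ∷ y ∷ []) e))))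
            (λ x x' s _ → cong χ (≢true⇒≡false λ e →
              ¬SameRel-[]-∷ʳ 3 a s y (proj₂ (proj₂ (proj₁ (sameOrder⇒SameOrder (3 ∷ 1 ∷ 2 ∷ []) (a ∷ x ∷ x' ∷ (s ∷ʳ y)) e)))))))
         (trans (∑-cong _ _ xs (λ x _ → cong χ (sameOrder-312 {a} {x} {y} a≢y))) (guarded (y <ᵇ a)))))
  where
    guarded : ∀ b → countᵇ (λ x → b ∧ (x <ᵇ y)) xs ≡ χ b * #below y xs
    guarded true = sym (+-identityʳ (#below y xs))
    guarded false = countᵇ-zero _ xs (λ _ _ → refl)

occ312-across-∷ʳ : ∀ xs ys y → ¬ (y ∈ xs) →
                   occ312-across xs (ys ∷ʳ y) ≡ occ312-across xs ys + #above y xs * #below y ys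
occ312-across-∷ʳ [] ys y y∉ = refl
occ312-across-∷ʳ (a ∷ xs) ys y y∉ rewrite occ312-∷ʳ a ys y (λ { refl → y∉ (here refl) })
  | occ312-across-∷ʳ xs ys y (λ y∈ → y∉ (there y∈)) | *-distribʳ-+ (#below y ys) (χ (y <ᵇ a)) (#above y xs)
  = interchange (occ312 a ys) _ _ _

-- The occurrences through the maximum that end with an entry y appended to ys.
newOccurrences : ℕ → List ℕ → List ℕ → ℕ
newOccurrences y xs ys = #above y ys + #above y xs * #below y ys

occurrencesThroughMax-∷ʳ : ∀ xs ys y → ¬ (y ∈ xs) → ¬ (y ∈ ys) →
  occurrencesThroughMax xs (ys ∷ʳ y) ≡ occurrencesThroughMax xs ys + newOccurrences y xs ys
occurrencesThroughMax-∷ʳ xs ys y y∉xs y∉ys rewrite inversions-∷ʳ ys y y∉ys | occ312-across-∷ʳ xs ys y y∉xs =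
  interchange (inversions ys) _ _ _

-- Crossings

crosses : List ℕ → List ℕ → Bool
crosses xs ys = any (λ x → any (_<ᵇ x) ys) xs

anyAbove : ℕ → List ℕ → Bool
anyAbove y xs = any (y <ᵇ_) xs

-- The cuts after the entries of ys at which some entry on the left (in xs or ys)
-- exceeds some entry on the right.
crossings : List ℕ → List ℕ → ℕ
crossings xs [] = 0
crossings xs (b ∷ ys) = χ (crosses (xs ∷ʳ b) ys) + crossings (xs ∷ʳ b) ys

-- The cuts of ys that become crossings when y is appended to ys.
newCrossings : ℕ → List ℕ → List ℕ → ℕ
newCrossings y xs [] = 0
newCrossings y xs (b ∷ ys) = χ (not (crosses (xs ∷ʳ b) ys) ∧ anyAbove y (xs ∷ʳ b)) + newCrossings y (xs ∷ʳ b) ys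

∈-∷ʳ⁺ˡ : ∀ {x : ℕ} {xs} b → x ∈ xs → x ∈ (xs ∷ʳ b)
∈-∷ʳ⁺ˡ b x∈ = ∈-++⁺ˡ x∈

∈-∷ʳ⁺ʳ : ∀ (xs : List ℕ) b → b ∈ (xs ∷ʳ b)
∈-∷ʳ⁺ʳ xs b = ∈-++⁺ʳ xs (here refl)

crosses-intro : ∀ {xs ys x z} → x ∈ xs → z ∈ ys → z < x → crosses xs ys ≡ true
crosses-intro x∈ z∈ z<x = any-intro _ x∈ (any-intro _ z∈ (<⇒<ᵇ≡true z<x))

crosses≡false⇒≤ : ∀ {xs ys x z} → crosses xs ys ≡ false → x ∈ xs → z ∈ ys → x ≤ z
crosses≡false⇒≤ {xs} {ys} {x} {z} h x∈ z∈ = <ᵇ≡false⇒≥ z x (any-false _ ys (any-false _ xs h x x∈) z z∈)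

crosses-[] : ∀ xs → crosses xs [] ≡ false
crosses-[] [] = refl
crosses-[] (x ∷ xs) = crosses-[] xs

crosses-∷ʳ : ∀ xs ys y → crosses xs (ys ∷ʳ y) ≡ crosses xs ys ∨ anyAbove y xs
crosses-∷ʳ [] ys y = refl
crosses-∷ʳ (x ∷ xs) ys y rewrite any-++ (_<ᵇ x) ys (y ∷ []) | crosses-∷ʳ xs ys y =
  shuffle (any (_<ᵇ x) ys) (y <ᵇ x) (crosses xs ys) (anyAbove y xs)
  where
    shuffle : ∀ a b c d → (a ∨ (b ∨ false)) ∨ (c ∨ d) ≡ (a ∨ c) ∨ (b ∨ d)
    shuffle true b c d = refl
    shuffle false true true d = refl
    shuffle false true false d = refl
    shuffle false false c d = refl

anyAbove-intro : ∀ {y x xs} → x ∈ xs → y < x → anyAbove y xs ≡ true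
anyAbove-intro x∈ y<x = any-intro _ x∈ (<⇒<ᵇ≡true y<x)

anyAbove-∷ʳ-false : ∀ {y xs b} → anyAbove y xs ≡ false → b < y → anyAbove y (xs ∷ʳ b) ≡ false
anyAbove-∷ʳ-false {y} {xs} {b} h b<y rewrite any-++ (y <ᵇ_) xs (b ∷ []) | h | ≥⇒<ᵇ≡false {y} {b} (<⇒≤ b<y) = refl

anyAbove⇒#above≥1 : ∀ y xs → anyAbove y xs ≡ true → 1 ≤ #above y xs
anyAbove⇒#above≥1 y xs e with a , a∈ , ya ← any-elim (y <ᵇ_) xs e = countᵇ-pos _ a∈ ya

χ-∨ : ∀ c q → χ (c ∨ q) ≡ χ c + χ (not c ∧ q)
χ-∨ true q = refl
χ-∨ false q = refl

crossings-∷ʳ : ∀ xs ys y → crossings xs (ys ∷ʳ y) ≡ crossings xs ys + newCrossings y xs ys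
crossings-∷ʳ xs [] y rewrite crosses-[] (xs ∷ʳ y) = refl
crossings-∷ʳ xs (b ∷ ys) y rewrite crosses-∷ʳ (xs ∷ʳ b) ys y | crossings-∷ʳ (xs ∷ʳ b) ys y
  | χ-∨ (crosses (xs ∷ʳ b) ys) (anyAbove y (xs ∷ʳ b)) = interchange (χ (crosses (xs ∷ʳ b) ys)) _ _ _

¬∈-∷⇒≢ : ∀ {y b : ℕ} {ys} → ¬ (y ∈ (b ∷ ys)) → b ≢ y
¬∈-∷⇒≢ y∉ refl = y∉ (here refl)

¬∈-∷⇒¬∈ : ∀ {y b : ℕ} {ys} → ¬ (y ∈ (b ∷ ys)) → ¬ (y ∈ ys)
¬∈-∷⇒¬∈ y∉ y∈ = y∉ (there y∈)

newCrossings-allAbove : ∀ y xs ys → (∀ b → b ∈ ys → y < b) → newCrossings y xs ys ≤ #above y ys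
newCrossings-allAbove y xs [] h = z≤n
newCrossings-allAbove y xs (b ∷ ys) h rewrite <⇒<ᵇ≡true (h b (here refl)) =
  +-mono-≤ (χ≤1 _) (newCrossings-allAbove y (xs ∷ʳ b) ys (λ z z∈ → h z (there z∈)))

newCrossings-allAbove-descent : ∀ y xs ys u v → (∀ b → b ∈ ys → y < b) → (u ∷ v ∷ []) ⊑ ys → v < u →
                                suc (newCrossings y xs ys) ≤ #above y ys
newCrossings-allAbove-descent y xs (b ∷ ys) u v h (skip b q) v<u rewrite <⇒<ᵇ≡true (h b (here refl)) =
  subst (_≤ suc (#above y ys)) (+-suc _ (newCrossings y (xs ∷ʳ b) ys))
    (+-mono-≤ (χ≤1 _) (newCrossings-allAbove-descent y (xs ∷ʳ b) ys u v (λ z z∈ → h z (there z∈)) q v<u))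
newCrossings-allAbove-descent y xs (u ∷ ys) u v h (keep u q) v<u
  rewrite <⇒<ᵇ≡true (h u (here refl)) | crosses-intro {xs ∷ʳ u} {ys} (∈-∷ʳ⁺ʳ xs u) (∈-resp-⊑ (here refl) q) v<u =
  s≤s (newCrossings-allAbove y (xs ∷ʳ u) ys (λ z z∈ → h z (there z∈)))

-- A new crossing at a cut other than the last forces the entry after the cut to exceed x > y.
newCrossings-someAbove : ∀ y xs ys x → x ∈ xs → y < x → ¬ (y ∈ ys) → newCrossings y xs ys ≤ #above y ys + 1
newCrossings-someAbove y xs [] x x∈ y<x y∉ = z≤n
newCrossings-someAbove y xs (b ∷ ys) x x∈ y<x y∉ with ≢⇒<⊎> (¬∈-∷⇒≢ y∉)
... | inj₂ y<b rewrite <⇒<ᵇ≡true y<b =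
  +-mono-≤ (χ≤1 _) (newCrossings-someAbove y (xs ∷ʳ b) ys x (∈-∷ʳ⁺ˡ b x∈) y<x (¬∈-∷⇒¬∈ y∉))
... | inj₁ b<y with crosses (xs ∷ʳ b) ys in eq
...   | true rewrite ≥⇒<ᵇ≡false {y} {b} (<⇒≤ b<y) =
  newCrossings-someAbove y (xs ∷ʳ b) ys x (∈-∷ʳ⁺ˡ b x∈) y<x (¬∈-∷⇒¬∈ y∉)
...   | false rewrite ≥⇒<ᵇ≡false {y} {b} (<⇒≤ b<y) | anyAbove-intro {y} {x} {xs ∷ʳ b} (∈-∷ʳ⁺ˡ b x∈) y<x =
  subst (suc (newCrossings y (xs ∷ʳ b) ys) ≤_) (+-comm 1 (#above y ys))
    (s≤s (newCrossings-allAbove y (xs ∷ʳ b) ys (λ z z∈ → <-≤-trans y<x (crosses≡false⇒≤ eq (∈-∷ʳ⁺ˡ b x∈) z∈))))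

newCrossings-aboveHead : ∀ y xs b ys → y < b → ¬ (y ∈ ys) → newCrossings y xs (b ∷ ys) ≤ #above y (b ∷ ys)
newCrossings-aboveHead y xs b ys y<b y∉ with crosses (xs ∷ʳ b) ys in eq
... | true rewrite <⇒<ᵇ≡true y<b =
  subst (newCrossings y (xs ∷ʳ b) ys ≤_) (+-comm (#above y ys) 1)
    (newCrossings-someAbove y (xs ∷ʳ b) ys b (∈-∷ʳ⁺ʳ xs b) y<b y∉)
... | false rewrite <⇒<ᵇ≡true y<b | anyAbove-intro {y} {b} {xs ∷ʳ b} (∈-∷ʳ⁺ʳ xs b) y<b =
  s≤s (newCrossings-allAbove y (xs ∷ʳ b) ys (λ z z∈ → <-≤-trans y<b (crosses≡false⇒≤ eq (∈-∷ʳ⁺ʳ xs b) z∈)))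

newCrossings-noneAbove : ∀ y xs ys → anyAbove y xs ≡ false → ¬ (y ∈ ys) → newCrossings y xs ys ≤ #above y ys
newCrossings-noneAbove y xs [] h y∉ = z≤n
newCrossings-noneAbove y xs (b ∷ ys) h y∉ with ≢⇒<⊎> (¬∈-∷⇒≢ y∉)
... | inj₂ y<b = newCrossings-aboveHead y xs b ys y<b (¬∈-∷⇒¬∈ y∉)
... | inj₁ b<y rewrite ≥⇒<ᵇ≡false {y} {b} (<⇒≤ b<y) | anyAbove-∷ʳ-false {y} {xs} h b<y
  | ∧-zeroʳ (not (crosses (xs ∷ʳ b) ys)) =
  newCrossings-noneAbove y (xs ∷ʳ b) ys (anyAbove-∷ʳ-false {y} {xs} h b<y) (¬∈-∷⇒¬∈ y∉)

newCrossings-someAbove-between : ∀ y xs ys x v → x ∈ xs → y < x → v ∈ ys → y < v → v < x → ¬ (y ∈ ys) →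
                                 newCrossings y xs ys ≤ #above y ys
newCrossings-someAbove-between y xs (b ∷ ys) x v x∈ y<x v∈ y<v v<x y∉ with ≢⇒<⊎> (¬∈-∷⇒≢ y∉)
... | inj₂ y<b = newCrossings-aboveHead y xs b ys y<b (¬∈-∷⇒¬∈ y∉)
... | inj₁ b<y with v∈
...   | here refl = ⊥-elim (<-asym b<y y<v)
...   | there v∈ys rewrite ≥⇒<ᵇ≡false {y} {b} (<⇒≤ b<y) | crosses-intro {xs ∷ʳ b} {ys} (∈-∷ʳ⁺ˡ b x∈) v∈ys v<x =
  newCrossings-someAbove-between y (xs ∷ʳ b) ys x v (∈-∷ʳ⁺ˡ b x∈) y<x v∈ys y<v v<x (¬∈-∷⇒¬∈ y∉)

newCrossings-someAbove-descent : ∀ y xs ys x u v → x ∈ xs → y < x → (u ∷ v ∷ []) ⊑ ys → y < v → v < u → ¬ (y ∈ ys) →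
                                 newCrossings y xs ys ≤ #above y ys
newCrossings-someAbove-descent y xs (b ∷ ys) x u v x∈ y<x q y<v v<u y∉ with ≢⇒<⊎> (¬∈-∷⇒≢ y∉)
... | inj₂ y<b = newCrossings-aboveHead y xs b ys y<b (¬∈-∷⇒¬∈ y∉)
... | inj₁ b<y with q
...   | keep _ _ = ⊥-elim (<-asym b<y (<-trans y<v v<u))
...   | skip _ q' with crosses (xs ∷ʳ b) ys in eq
...     | true rewrite ≥⇒<ᵇ≡false {y} {b} (<⇒≤ b<y) =
  newCrossings-someAbove-descent y (xs ∷ʳ b) ys x u v (∈-∷ʳ⁺ˡ b x∈) y<x q' y<v v<u (¬∈-∷⇒¬∈ y∉)
...     | false rewrite ≥⇒<ᵇ≡false {y} {b} (<⇒≤ b<y) | anyAbove-intro {y} {x} {xs ∷ʳ b} (∈-∷ʳ⁺ˡ b x∈) y<x =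
  newCrossings-allAbove-descent y (xs ∷ʳ b) ys u v
    (λ z z∈ → <-≤-trans y<x (crosses≡false⇒≤ eq (∈-∷ʳ⁺ˡ b x∈) z∈)) q' v<u

newCrossings-noneAbove-descent : ∀ y xs ys u v → anyAbove y xs ≡ false → (u ∷ v ∷ []) ⊑ ys → y < v → v < u → ¬ (y ∈ ys) →
                                 suc (newCrossings y xs ys) ≤ #above y ys
newCrossings-noneAbove-descent y xs (b ∷ ys) u v h q y<v v<u y∉ with ≢⇒<⊎> (¬∈-∷⇒≢ y∉)
... | inj₁ b<y with q
...   | keep _ _ = ⊥-elim (<-asym b<y (<-trans y<v v<u))
...   | skip _ q' rewrite ≥⇒<ᵇ≡false {y} {b} (<⇒≤ b<y) | anyAbove-∷ʳ-false {y} {xs} h b<y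
  | ∧-zeroʳ (not (crosses (xs ∷ʳ b) ys)) =
  newCrossings-noneAbove-descent y (xs ∷ʳ b) ys u v (anyAbove-∷ʳ-false {y} {xs} h b<y) q' y<v v<u (¬∈-∷⇒¬∈ y∉)
newCrossings-noneAbove-descent y xs (b ∷ ys) u v h q y<v v<u y∉ | inj₂ y<b with q
... | keep _ q' rewrite <⇒<ᵇ≡true y<b | crosses-intro {xs ∷ʳ b} {ys} (∈-∷ʳ⁺ʳ xs b) (∈-resp-⊑ (here refl) q') v<u =
  s≤s (newCrossings-someAbove-between y (xs ∷ʳ b) ys b v (∈-∷ʳ⁺ʳ xs b) y<b (∈-resp-⊑ (here refl) q') y<v v<u
                                       (¬∈-∷⇒¬∈ y∉))
... | skip _ q' with crosses (xs ∷ʳ b) ys in eq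
...   | true rewrite <⇒<ᵇ≡true y<b =
  s≤s (newCrossings-someAbove-descent y (xs ∷ʳ b) ys b u v (∈-∷ʳ⁺ʳ xs b) y<b q' y<v v<u (¬∈-∷⇒¬∈ y∉))
...   | false rewrite <⇒<ᵇ≡true y<b | anyAbove-intro {y} {b} {xs ∷ʳ b} (∈-∷ʳ⁺ʳ xs b) y<b =
  s≤s (newCrossings-allAbove-descent y (xs ∷ʳ b) ys u v
         (λ z z∈ → <-≤-trans y<b (crosses≡false⇒≤ eq (∈-∷ʳ⁺ʳ xs b) z∈)) q' v<u)

newCrossings-someAbove-aboveBelow : ∀ y xs ys x v z → x ∈ xs → y < x → (v ∷ z ∷ []) ⊑ ys → y < v → z < y → ¬ (y ∈ ys) →
                                    newCrossings y xs ys ≤ #above y ys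
newCrossings-someAbove-aboveBelow y xs (b ∷ ys) x v z x∈ y<x q y<v z<y y∉ with ≢⇒<⊎> (¬∈-∷⇒≢ y∉)
... | inj₂ y<b = newCrossings-aboveHead y xs b ys y<b (¬∈-∷⇒¬∈ y∉)
... | inj₁ b<y with q
...   | keep _ _ = ⊥-elim (<-asym b<y y<v)
...   | skip _ q' rewrite ≥⇒<ᵇ≡false {y} {b} (<⇒≤ b<y)
  | crosses-intro {xs ∷ʳ b} {ys} (∈-∷ʳ⁺ˡ b x∈) (∈-resp-⊑ (there (here refl)) q') (<-trans z<y y<x) =
  newCrossings-someAbove-aboveBelow y (xs ∷ʳ b) ys x v z (∈-∷ʳ⁺ˡ b x∈) y<x q' y<v z<y (¬∈-∷⇒¬∈ y∉)

newCrossings-noneAbove-aboveAboveBelow : ∀ y xs ys u v z → anyAbove y xs ≡ false → (u ∷ v ∷ z ∷ []) ⊑ ys →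
  y < u → y < v → z < y → ¬ (y ∈ ys) → suc (newCrossings y xs ys) ≤ #above y ys
newCrossings-noneAbove-aboveAboveBelow y xs (b ∷ ys) u v z h q y<u y<v z<y y∉ with ≢⇒<⊎> (¬∈-∷⇒≢ y∉)
... | inj₁ b<y with q
...   | keep _ _ = ⊥-elim (<-asym b<y y<u)
...   | skip _ q' rewrite ≥⇒<ᵇ≡false {y} {b} (<⇒≤ b<y) | anyAbove-∷ʳ-false {y} {xs} h b<y
  | ∧-zeroʳ (not (crosses (xs ∷ʳ b) ys)) =
  newCrossings-noneAbove-aboveAboveBelow y (xs ∷ʳ b) ys u v z (anyAbove-∷ʳ-false {y} {xs} h b<y) q' y<u y<v z<y
                                         (¬∈-∷⇒¬∈ y∉)
newCrossings-noneAbove-aboveAboveBelow y xs (b ∷ ys) u v z h q y<u y<v z<y y∉ | inj₂ y<b with q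
... | keep _ q' rewrite <⇒<ᵇ≡true y<b
  | crosses-intro {xs ∷ʳ b} {ys} (∈-∷ʳ⁺ʳ xs b) (∈-resp-⊑ (there (here refl)) q') (<-trans z<y y<b) =
  s≤s (newCrossings-someAbove-aboveBelow y (xs ∷ʳ b) ys b v z (∈-∷ʳ⁺ʳ xs b) y<b q' y<v z<y (¬∈-∷⇒¬∈ y∉))
... | skip _ q' rewrite <⇒<ᵇ≡true y<b
  | crosses-intro {xs ∷ʳ b} {ys} (∈-∷ʳ⁺ʳ xs b) (∈-resp-⊑ (there (there (here refl))) q') (<-trans z<y y<b) =
  s≤s (newCrossings-someAbove-aboveBelow y (xs ∷ʳ b) ys b v z (∈-∷ʳ⁺ʳ xs b) y<b (⊑-trans (skip u (⊑-refl _)) q')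
                                         y<v z<y (¬∈-∷⇒¬∈ y∉))

cost : ℕ → ℕ → ℕ → ℕ
cost α y b = χ (y <ᵇ b) + α * χ (b <ᵇ y)

∑cost≡ : ∀ α y xs → ∑ (cost α y) xs ≡ #above y xs + α * #below y xs
∑cost≡ α y [] = sym (*-zeroʳ α)
∑cost≡ α y (b ∷ xs) rewrite ∑cost≡ α y xs | *-distribˡ-+ α (χ (b <ᵇ y)) (#below y xs) =
  interchange (χ (y <ᵇ b)) _ _ _

cost≥1 : ∀ α y b → b ≢ y → 1 ≤ α → 1 ≤ cost α y b
cost≥1 α y b b≢y 1≤α with ≢⇒<⊎> b≢y
... | inj₁ b<y rewrite ≥⇒<ᵇ≡false {y} {b} (<⇒≤ b<y) | <⇒<ᵇ≡true b<y | *-identityʳ α = 1≤α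
... | inj₂ y<b rewrite <⇒<ᵇ≡true y<b = s≤s z≤n

cost≥2 : ∀ α y b → b < y → 2 ≤ α → 2 ≤ cost α y b
cost≥2 α y b b<y 2≤α rewrite ≥⇒<ᵇ≡false {y} {b} (<⇒≤ b<y) | <⇒<ᵇ≡true b<y | *-identityʳ α = 2≤α

newCrossings≤∑cost : ∀ y xs ys α → 1 ≤ α → ¬ (y ∈ ys) → newCrossings y xs ys ≤ ∑ (cost α y) ys
newCrossings≤∑cost y xs [] α 1≤α y∉ = z≤n
newCrossings≤∑cost y xs (b ∷ ys) α 1≤α y∉ =
  +-mono-≤ (≤-trans (χ≤1 _) (cost≥1 α y b (¬∈-∷⇒≢ y∉) 1≤α)) (newCrossings≤∑cost y (xs ∷ʳ b) ys α 1≤α (¬∈-∷⇒¬∈ y∉))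

HasCrossing : List ℕ → List ℕ → Set
HasCrossing xs [] = ⊥
HasCrossing xs (b ∷ ys) = crosses (xs ∷ʳ b) ys ≡ true ⊎ HasCrossing (xs ∷ʳ b) ys

descent⇒HasCrossing : ∀ xs ys x z → (x ∷ z ∷ []) ⊑ ys → z < x → HasCrossing xs ys
descent⇒HasCrossing xs (b ∷ ys) x z (skip b q) z<x = inj₂ (descent⇒HasCrossing (xs ∷ʳ b) ys x z q z<x)
descent⇒HasCrossing xs (x ∷ ys) x z (keep x q) z<x = inj₁ (crosses-intro (∈-∷ʳ⁺ʳ xs x) (∈-resp-⊑ (here refl) q) z<x)

below-prefix⇒HasCrossing : ∀ xs ys x w z → x ∈ xs → (w ∷ z ∷ []) ⊑ ys → z < x → HasCrossing xs ys
below-prefix⇒HasCrossing xs (b ∷ ys) x w z x∈ (skip b q) z<x =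
  inj₂ (below-prefix⇒HasCrossing (xs ∷ʳ b) ys x w z (∈-∷ʳ⁺ˡ b x∈) q z<x)
below-prefix⇒HasCrossing xs (w ∷ ys) x w z x∈ (keep w q) z<x =
  inj₁ (crosses-intro (∈-∷ʳ⁺ˡ w x∈) (∈-resp-⊑ (here refl) q) z<x)

newCrossings<∑cost-crossing : ∀ y xs ys α → 1 ≤ α → ¬ (y ∈ ys) → HasCrossing xs ys →
                              suc (newCrossings y xs ys) ≤ ∑ (cost α y) ys
newCrossings<∑cost-crossing y xs (b ∷ ys) α 1≤α y∉ (inj₁ e) rewrite e =
  +-mono-≤ (cost≥1 α y b (¬∈-∷⇒≢ y∉) 1≤α) (newCrossings≤∑cost y (xs ∷ʳ b) ys α 1≤α (¬∈-∷⇒¬∈ y∉))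
newCrossings<∑cost-crossing y xs (b ∷ ys) α 1≤α y∉ (inj₂ c) =
  subst (_≤ ∑ (cost α y) (b ∷ ys)) (+-suc _ (newCrossings y (xs ∷ʳ b) ys))
    (+-mono-≤ (≤-trans (χ≤1 _) (cost≥1 α y b (¬∈-∷⇒≢ y∉) 1≤α))
              (newCrossings<∑cost-crossing y (xs ∷ʳ b) ys α 1≤α (¬∈-∷⇒¬∈ y∉) c))

newCrossings<∑cost-below : ∀ y xs ys α z → 2 ≤ α → ¬ (y ∈ ys) → z ∈ ys → z < y →
                           suc (newCrossings y xs ys) ≤ ∑ (cost α y) ys
newCrossings<∑cost-below y xs (b ∷ ys) α z 2≤α y∉ (here refl) z<y =
  +-mono-≤ (≤-trans (s≤s (χ≤1 _)) (cost≥2 α y b z<y 2≤α))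
           (newCrossings≤∑cost y (xs ∷ʳ b) ys α (≤-trans (s≤s z≤n) 2≤α) (¬∈-∷⇒¬∈ y∉))
newCrossings<∑cost-below y xs (b ∷ ys) α z 2≤α y∉ (there z∈) z<y =
  subst (_≤ ∑ (cost α y) (b ∷ ys)) (+-suc _ (newCrossings y (xs ∷ʳ b) ys))
    (+-mono-≤ (≤-trans (χ≤1 _) (cost≥1 α y b (¬∈-∷⇒≢ y∉) (≤-trans (s≤s z≤n) 2≤α)))
              (newCrossings<∑cost-below y (xs ∷ʳ b) ys α z 2≤α (¬∈-∷⇒¬∈ y∉) z∈ z<y))

-- The configurations, left by an occurrence of a pattern of Φ after deleting its maximum,
-- that save one unit in newCrossings-bound.
data Slack (xs ys : List ℕ) (y : ℕ) : Set where
  descentAbove : ∀ u v → (u ∷ v ∷ []) ⊑ ys → y < v → v < u → Slack xs ys y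
  aboveAboveBelow : ∀ u v z → (u ∷ v ∷ z ∷ []) ⊑ ys → y < u → y < v → z < y → Slack xs ys y
  belowPrefix : ∀ a w z → a ∈ xs → y < a → (w ∷ z ∷ []) ⊑ ys → z < a → Slack xs ys y
  descentAfterAbove : ∀ a x z → a ∈ xs → y < a → (x ∷ z ∷ []) ⊑ ys → z < x → Slack xs ys y
  twoAboveBelow : ∀ z → 2 ≤ #above y xs → z ∈ ys → z < y → Slack xs ys y

Slack-mono : ∀ {xs xs' ys ys' y} → xs' ⊑ xs → ys' ⊑ ys → Slack xs' ys' y → Slack xs ys y
Slack-mono p q (descentAbove u v r y<v v<u) = descentAbove u v (⊑-trans r q) y<v v<u
Slack-mono p q (aboveAboveBelow u v z r y<u y<v z<y) = aboveAboveBelow u v z (⊑-trans r q) y<u y<v z<y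
Slack-mono p q (belowPrefix a w z a∈ y<a r z<a) = belowPrefix a w z (∈-resp-⊑ a∈ p) y<a (⊑-trans r q) z<a
Slack-mono p q (descentAfterAbove a x z a∈ y<a r z<x) = descentAfterAbove a x z (∈-resp-⊑ a∈ p) y<a (⊑-trans r q) z<x
Slack-mono {y = y} p q (twoAboveBelow z 2≤ z∈ z<y) = twoAboveBelow z (≤-trans 2≤ (⊑-countᵇ (y <ᵇ_) p)) (∈-resp-⊑ z∈ q) z<y

newCrossings-bound : ∀ y xs ys → ¬ (y ∈ ys) → newCrossings y xs ys ≤ newOccurrences y xs ys
newCrossings-bound y xs ys y∉ with anyAbove y xs in e
... | true = subst (newCrossings y xs ys ≤_) (∑cost≡ (#above y xs) y ys)
               (newCrossings≤∑cost y xs ys (#above y xs) (anyAbove⇒#above≥1 y xs e) y∉)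
... | false = ≤-trans (newCrossings-noneAbove y xs ys e y∉) (m≤m+n _ _)

module _ (y : ℕ) (xs ys : List ℕ) (y∉ : ¬ (y ∈ ys)) where

  private
    Goal : Set
    Goal = suc (newCrossings y xs ys) ≤ newOccurrences y xs ys

    viaCost : suc (newCrossings y xs ys) ≤ ∑ (cost (#above y xs) y) ys → Goal
    viaCost = subst (suc (newCrossings y xs ys) ≤_) (∑cost≡ (#above y xs) y ys)

    viaCrossing : 1 ≤ #above y xs → HasCrossing xs ys → Goal
    viaCrossing 1≤ c = viaCost (newCrossings<∑cost-crossing y xs ys _ 1≤ y∉ c)

    viaNoneAbove : suc (newCrossings y xs ys) ≤ #above y ys → Goal
    viaNoneAbove h = ≤-trans h (m≤m+n _ _)

  newCrossings-bound-strict : Slack xs ys y → Goal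
  newCrossings-bound-strict (descentAbove u v q y<v v<u) with anyAbove y xs in e
  ... | true = viaCrossing (anyAbove⇒#above≥1 y xs e) (descent⇒HasCrossing xs ys u v q v<u)
  ... | false = viaNoneAbove (newCrossings-noneAbove-descent y xs ys u v e q y<v v<u y∉)
  newCrossings-bound-strict (aboveAboveBelow u v z q y<u y<v z<y) with anyAbove y xs in e
  ... | true = viaCrossing (anyAbove⇒#above≥1 y xs e)
                 (descent⇒HasCrossing xs ys u z (⊑-trans (keep u (skip v (⊑-refl _))) q) (<-trans z<y y<u))
  ... | false = viaNoneAbove (newCrossings-noneAbove-aboveAboveBelow y xs ys u v z e q y<u y<v z<y y∉)
  newCrossings-bound-strict (belowPrefix a w z a∈ y<a q z<a) =
    viaCrossing (anyAbove⇒#above≥1 y xs (anyAbove-intro a∈ y<a)) (below-prefix⇒HasCrossing xs ys a w z a∈ q z<a)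
  newCrossings-bound-strict (descentAfterAbove a x z a∈ y<a q z<x) =
    viaCrossing (anyAbove⇒#above≥1 y xs (anyAbove-intro a∈ y<a)) (descent⇒HasCrossing xs ys x z q z<x)
  newCrossings-bound-strict (twoAboveBelow z 2≤ z∈ z<y) = viaCost (newCrossings<∑cost-below y xs ys _ z 2≤ y∉ z∈ z<y)

HasSlack : List ℕ → List ℕ → Set
HasSlack xs ys = Σ (List ℕ) λ ys' → Σ ℕ λ y → (ys' ∷ʳ y) ⊑ ys × Slack xs ys' y

crossings≤occurrencesThroughMax : ∀ xs ys → Reverse ys → Distinct (xs ++ ys) →
                                  crossings xs ys ≤ occurrencesThroughMax xs ys
crossings≤occurrencesThroughMax xs .[] [] d = z≤n
crossings≤occurrencesThroughMax xs .(ys ∷ʳ y) (ys ∶ r ∶ʳ y) d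
  with y∉xs , y∉ys , d' ← Distinct-∷ʳ-split xs ys y d = begin
  crossings xs (ys ∷ʳ y)
    ≡⟨ crossings-∷ʳ xs ys y ⟩
  crossings xs ys + newCrossings y xs ys
    ≤⟨ +-mono-≤ (crossings≤occurrencesThroughMax xs ys r d') (newCrossings-bound y xs ys y∉ys) ⟩
  occurrencesThroughMax xs ys + newOccurrences y xs ys
    ≡⟨ sym (occurrencesThroughMax-∷ʳ xs ys y y∉xs y∉ys) ⟩
  occurrencesThroughMax xs (ys ∷ʳ y) ∎
  where open ≤-Reasoning

crossings<occurrencesThroughMax : ∀ xs ys → Reverse ys → Distinct (xs ++ ys) → HasSlack xs ys →
                                  suc (crossings xs ys) ≤ occurrencesThroughMax xs ys
crossings<occurrencesThroughMax xs .[] [] d (ys' , y , q , _) = ⊥-elim (∷ʳ⋢[] ys' y q)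
crossings<occurrencesThroughMax xs .(ys ∷ʳ y) (ys ∶ r ∶ʳ y) d (ys' , y' , q , s)
  with y∉xs , y∉ys , d' ← Distinct-∷ʳ-split xs ys y d = begin
  suc (crossings xs (ys ∷ʳ y))
    ≡⟨ cong suc (crossings-∷ʳ xs ys y) ⟩
  suc (crossings xs ys + newCrossings y xs ys)
    ≤⟨ bySlackPosition (⊑-∷ʳ⁻ ys y q) ⟩
  occurrencesThroughMax xs ys + newOccurrences y xs ys
    ≡⟨ sym (occurrencesThroughMax-∷ʳ xs ys y y∉xs y∉ys) ⟩
  occurrencesThroughMax xs (ys ∷ʳ y) ∎
  where
    open ≤-Reasoning
    bySlackPosition : (ys' ∷ʳ y') ⊑ ys ⊎ Σ (List ℕ) (λ zs → ys' ∷ʳ y' ≡ zs ∷ʳ y × zs ⊑ ys) →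
      suc (crossings xs ys + newCrossings y xs ys) ≤ occurrencesThroughMax xs ys + newOccurrences y xs ys
    bySlackPosition (inj₁ q') =
      +-mono-≤ (crossings<occurrencesThroughMax xs ys r d' (ys' , y' , q' , s)) (newCrossings-bound y xs ys y∉ys)
    bySlackPosition (inj₂ (zs , eq , q')) with refl , refl ← ∷ʳ-injective ys' zs eq =
      subst (_≤ occurrencesThroughMax xs ys + newOccurrences y xs ys)
            (+-suc (crossings xs ys) (newCrossings y xs ys))
        (+-mono-≤ (crossings≤occurrencesThroughMax xs ys r d')
                  (newCrossings-bound-strict y xs ys y∉ys (Slack-mono (⊑-refl xs) q' s)))

-- Inserting the maximum

Below : ℕ → List ℕ → Set
Below n xs = ∀ x → x ∈ xs → x < n

Below⇒∉ : ∀ {n xs} → Below n xs → ¬ (n ∈ xs)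
Below⇒∉ xs<n n∈ = <-irrefl refl (xs<n _ n∈)

Below-⊑ : ∀ {n xs ys} → xs ⊑ ys → Below n ys → Below n xs
Below-⊑ q h x x∈ = h x (∈-resp-⊑ x∈ q)

sameOrder-321-max : ∀ n t → Below n t → sameOrder (3 ∷ 2 ∷ 1 ∷ []) (n ∷ t) ≡ sameOrder (2 ∷ 1 ∷ []) t
sameOrder-321-max n t t<n = bool-ext
  (λ e → SameOrder⇒sameOrder (2 ∷ 1 ∷ []) t (proj₂ (sameOrder⇒SameOrder (3 ∷ 2 ∷ 1 ∷ []) (n ∷ t) e)))
  (λ e → SameOrder⇒sameOrder (3 ∷ 2 ∷ 1 ∷ []) (n ∷ t) (extend t t<n (sameOrder⇒SameOrder (2 ∷ 1 ∷ []) t e)))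
  where
    extend : ∀ t → Below n t → SameOrder (2 ∷ 1 ∷ []) t → SameOrder (3 ∷ 2 ∷ 1 ∷ []) (n ∷ t)
    extend (c ∷ d ∷ []) t<n o =
      (sym (≥⇒<ᵇ≡false (<⇒≤ (t<n c (here refl)))) , sym (≥⇒<ᵇ≡false (<⇒≤ (t<n d (there (here refl))))) , tt) , o

sameOrder-3412-max : ∀ a n t → a < n → Below n t →
                     sameOrder (3 ∷ 4 ∷ 1 ∷ 2 ∷ []) (a ∷ n ∷ t) ≡ sameOrder (3 ∷ 1 ∷ 2 ∷ []) (a ∷ t)
sameOrder-3412-max a n t a<n t<n = bool-ext
  (λ e → let ((_ , r) , (_ , o)) = sameOrder⇒SameOrder (3 ∷ 4 ∷ 1 ∷ 2 ∷ []) (a ∷ n ∷ t) e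
         in SameOrder⇒sameOrder (3 ∷ 1 ∷ 2 ∷ []) (a ∷ t) (r , o))
  (λ e → SameOrder⇒sameOrder (3 ∷ 4 ∷ 1 ∷ 2 ∷ []) (a ∷ n ∷ t)
           (extend t t<n (sameOrder⇒SameOrder (3 ∷ 1 ∷ 2 ∷ []) (a ∷ t) e)))
  where
    extend : ∀ t → Below n t → SameOrder (3 ∷ 1 ∷ 2 ∷ []) (a ∷ t) → SameOrder (3 ∷ 4 ∷ 1 ∷ 2 ∷ []) (a ∷ n ∷ t)
    extend (c ∷ d ∷ []) t<n (r , o) =
      (sym (<⇒<ᵇ≡true a<n) , r) ,
      ((sym (≥⇒<ᵇ≡false (<⇒≤ (t<n c (here refl)))) , sym (≥⇒<ᵇ≡false (<⇒≤ (t<n d (there (here refl))))) , tt) , o)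

∈-++-∷ : ∀ (s : List ℕ) n t → n ∈ (s ++ n ∷ t)
∈-++-∷ s n t = ∈-++⁺ʳ s (here refl)

-- An occurrence of 321 through the new maximum n must use n as its 3.
countPattern-321-insertMax : ∀ xs n ys → Below n xs → Below n ys →
  countPattern (3 ∷ 2 ∷ 1 ∷ []) (xs ++ n ∷ ys) ≡ countPattern (3 ∷ 2 ∷ 1 ∷ []) (xs ++ ys) + inversions ys
countPattern-321-insertMax xs n ys xs<n ys<n rewrite ∑-subseqs-insert (λ s → χ (sameOrder (3 ∷ 2 ∷ 1 ∷ []) s)) xs n ys =
  cong (countPattern (3 ∷ 2 ∷ 1 ∷ []) (xs ++ ys) +_)
    (trans (∑-subseqs-[] _ xs (λ c s q → countᵇ-zero _ (subseqs ys) (λ t _ → ≢true⇒≡false λ e →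
              <⇒≱ (xs<n c (∈-resp-⊑ (here refl) q))
                (SameRel-below 3 (2 ∷ 1 ∷ []) c (s ++ n ∷ t) (proj₁ (sameOrder⇒SameOrder (3 ∷ 2 ∷ 1 ∷ []) (c ∷ (s ++ n ∷ t)) e))
                   (λ { _ (here refl) → s≤s (s≤s z≤n) ; _ (there (here refl)) → s≤s z≤n }) n (∈-++-∷ s n t)))))
      (countᵇ-cong _ _ (subseqs ys) (λ t t∈ → sameOrder-321-max n t (Below-⊑ (∈subseqs⇒⊑ ys t∈) ys<n))))

-- An occurrence of 3412 through the new maximum n must use n as its 4.
countPattern-3412-insertMax : ∀ xs n ys → Below n xs → Below n ys →
  countPattern (3 ∷ 4 ∷ 1 ∷ 2 ∷ []) (xs ++ n ∷ ys) ≡ countPattern (3 ∷ 4 ∷ 1 ∷ 2 ∷ []) (xs ++ ys) + occ312-across xs ys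
countPattern-3412-insertMax xs n ys xs<n ys<n rewrite ∑-subseqs-insert (λ s → χ (sameOrder (3 ∷ 4 ∷ 1 ∷ 2 ∷ []) s)) xs n ys =
  cong (countPattern (3 ∷ 4 ∷ 1 ∷ 2 ∷ []) (xs ++ ys) +_)
    (trans (∑-subseqs-singletons _ xs
              (countᵇ-zero _ (subseqs ys) (λ t t∈ → ≢true⇒≡false λ e →
                 n-first t t∈ (sameOrder⇒SameOrder (3 ∷ 4 ∷ 1 ∷ 2 ∷ []) (n ∷ t) e)))
              (λ c d s q → countᵇ-zero _ (subseqs ys) (λ t _ → ≢true⇒≡false λ e →
                <⇒≱ (xs<n c (∈-resp-⊑ (here refl) q))
                  (SameRel-below 3 (1 ∷ 2 ∷ []) c (s ++ n ∷ t)
                     (proj₂ (proj₁ (sameOrder⇒SameOrder (3 ∷ 4 ∷ 1 ∷ 2 ∷ []) (c ∷ d ∷ (s ++ n ∷ t)) e)))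
                     (λ { _ (here refl) → s≤s z≤n ; _ (there (here refl)) → s≤s (s≤s z≤n) }) n (∈-++-∷ s n t)))))
           (∑-cong _ _ xs (λ a a∈ → countᵇ-cong _ _ (subseqs ys) (λ t t∈ →
              sameOrder-3412-max a n t (xs<n a a∈) (Below-⊑ (∈subseqs⇒⊑ ys t∈) ys<n)))))
  where
    n-first : ∀ t → t ∈ subseqs ys → ¬ SameOrder (3 ∷ 4 ∷ 1 ∷ 2 ∷ []) (n ∷ t)
    n-first (c ∷ t) t∈ ((r , _) , _) = <-asym (ys<n c (∈-resp-⊑ (here refl) (∈subseqs⇒⊑ ys t∈))) (<ᵇ≡true⇒< n c (sym r))

-- An inversion through the new maximum n pairs n with an entry to its right.
inversions-insertMax : ∀ xs n ys → Below n xs → Below n ys →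
                       inversions (xs ++ n ∷ ys) ≡ inversions (xs ++ ys) + length ys
inversions-insertMax xs n ys xs<n ys<n rewrite ∑-subseqs-insert (λ s → χ (sameOrder (2 ∷ 1 ∷ []) s)) xs n ys =
  cong (inversions (xs ++ ys) +_)
    (trans (∑-subseqs-[] _ xs (λ c s q → countᵇ-zero _ (subseqs ys) (λ t _ → ≢true⇒≡false λ e →
              <⇒≱ (xs<n c (∈-resp-⊑ (here refl) q))
                (SameRel-below 2 (1 ∷ []) c (s ++ n ∷ t) (proj₁ (sameOrder⇒SameOrder (2 ∷ 1 ∷ []) (c ∷ (s ++ n ∷ t)) e))
                   (λ { _ (here refl) → s≤s z≤n }) n (∈-++-∷ s n t)))))
    (trans (∑-subseqs-singletons _ ys refl (λ c d s _ → cong χ (≢true⇒≡false λ e →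
              proj₂ (proj₁ (sameOrder⇒SameOrder (2 ∷ 1 ∷ []) (n ∷ c ∷ d ∷ s) e)))))
    (trans (∑-cong _ _ ys (λ c c∈ → cong χ (trans (sameOrder-21 {n} {c} (λ { refl → Below⇒∉ ys<n c∈ }))
                                                      (<⇒<ᵇ≡true (ys<n c c∈)))))
           (∑-one ys))))

count321-3412ᴸ : List ℕ → ℕ
count321-3412ᴸ xs = countPattern (3 ∷ 2 ∷ 1 ∷ []) xs + countPattern (3 ∷ 4 ∷ 1 ∷ 2 ∷ []) xs

count321-3412ᴸ-insertMax : ∀ xs n ys → Below n xs → Below n ys →
  count321-3412ᴸ (xs ++ n ∷ ys) ≡ count321-3412ᴸ (xs ++ ys) + occurrencesThroughMax xs ys
count321-3412ᴸ-insertMax xs n ys xs<n ys<n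
  rewrite countPattern-321-insertMax xs n ys xs<n ys<n | countPattern-3412-insertMax xs n ys xs<n ys<n =
  interchange (countPattern (3 ∷ 2 ∷ 1 ∷ []) (xs ++ ys)) _ _ _

any-++-∷-false : ∀ (p : ℕ → Bool) xs n ys → p n ≡ false → any p (xs ++ n ∷ ys) ≡ any p (xs ++ ys)
any-++-∷-false p [] n ys h rewrite h = refl
any-++-∷-false p (x ∷ xs) n ys h = cong (p x ∨_) (any-++-∷-false p xs n ys h)

crosses-removeMax : ∀ xs ys n zs → Below n xs → crosses xs (ys ++ n ∷ zs) ≡ crosses xs (ys ++ zs)
crosses-removeMax [] ys n zs h = refl
crosses-removeMax (x ∷ xs) ys n zs h
  rewrite any-++-∷-false (_<ᵇ x) ys n zs (≥⇒<ᵇ≡false (<⇒≤ (h x (here refl))))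
        | crosses-removeMax xs ys n zs (λ z z∈ → h z (there z∈)) = refl

crossings-pastMax : ∀ xs b ys n → n ∈ (xs ∷ʳ b) → Below n ys → crossings xs (b ∷ ys) ≡ length ys
crossings-pastMax xs b [] n n∈ h rewrite crosses-[] (xs ∷ʳ b) = refl
crossings-pastMax xs b (c ∷ ys) n n∈ h rewrite crosses-intro {xs ∷ʳ b} {c ∷ ys} n∈ (here refl) (h c (here refl)) =
  cong suc (crossings-pastMax (xs ∷ʳ b) c ys n (∈-∷ʳ⁺ˡ c n∈) (λ z z∈ → h z (there z∈)))

Below-∷ʳ : ∀ {n xs b} → Below n xs → b < n → Below n (xs ∷ʳ b)
Below-∷ʳ {xs = xs} h b<n x x∈ with ∈-++⁻ xs x∈
... | inj₁ x∈xs = h x x∈xs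
... | inj₂ (here refl) = b<n

-- The maximum n creates no crossing at the cuts inside xs, while every cut inside ys lies to
-- the right of n and so becomes a crossing, except the last one.
crossings-insertMax : ∀ ws xs n ys → Below n ws → Below n xs → Below n ys →
  crossings ws (xs ++ n ∷ ys) + crossings (ws ++ xs) ys ≡ crossings ws (xs ++ ys) + length ys
crossings-insertMax ws [] n ys ws<n xs<n ys<n
  rewrite crossings-pastMax ws n ys n (∈-∷ʳ⁺ʳ ws n) ys<n | ++-identityʳ ws = +-comm (length ys) (crossings ws ys)
crossings-insertMax ws (x ∷ xs) n ys ws<n xs<n ys<n
  rewrite crosses-removeMax (ws ∷ʳ x) xs n ys (Below-∷ʳ ws<n (xs<n x (here refl))) | sym (++-assoc ws (x ∷ []) xs) =
  trans (+-assoc (χ (crosses (ws ∷ʳ x) (xs ++ ys))) _ _)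
    (trans (cong (χ (crosses (ws ∷ʳ x) (xs ++ ys)) +_)
             (crossings-insertMax (ws ∷ʳ x) xs n ys (Below-∷ʳ ws<n (xs<n x (here refl))) (λ z z∈ → xs<n z (there z∈)) ys<n))
      (sym (+-assoc (χ (crosses (ws ∷ʳ x) (xs ++ ys))) _ _)))

-- Φ-values

occursWithMax : List ℕ → ℕ → List ℕ → Bool
occursWithMax p v s = sameOrder p s ∧ (maxList s ≡ᵇ v)

isΦValue : List ℕ → ℕ → Bool
isΦValue xs v = any (λ p → any (occursWithMax p v) (subseqs xs)) Φ

maxList-≥ : ∀ {x} s → x ∈ s → x ≤ maxList s
maxList-≥ (y ∷ s) (here refl) = m≤m⊔n y (maxList s)
maxList-≥ (y ∷ s) (there x∈) = ≤-trans (maxList-≥ s x∈) (m≤n⊔m y (maxList s))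

maxList-≤ : ∀ {x} s → All (_≤ x) s → maxList s ≤ x
maxList-≤ [] [] = z≤n
maxList-≤ (y ∷ s) (y≤x ∷ s≤x) = ⊔-lub y≤x (maxList-≤ s s≤x)

maxList-top : ∀ {x} s → x ∈ s → All (_≤ x) s → maxList s ≡ x
maxList-top s x∈ s≤x = ≤-antisym (maxList-≤ s s≤x) (maxList-≥ s x∈)

-- A Φ-occurrence with maximum v < n never uses n, so it survives the deletion of n.
isΦValue-removeMax : ∀ xs n ys v → v < n → isΦValue (xs ++ n ∷ ys) v ≡ true → isΦValue (xs ++ ys) v ≡ true
isΦValue-removeMax xs n ys v v<n e
  with p , p∈ , e₁ ← any-elim (λ p → any (occursWithMax p v) (subseqs (xs ++ n ∷ ys))) Φ e
  with s , s∈ , e₂ ← any-elim (occursWithMax p v) (subseqs (xs ++ n ∷ ys)) e₁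
  with _ , mx ← ∧-true {sameOrder p s} e₂ =
  any-intro (λ p → any (occursWithMax p v) (subseqs (xs ++ ys))) p∈
    (any-intro (occursWithMax p v) (⊑⇒∈subseqs (⊑-remove xs n ys (∈subseqs⇒⊑ (xs ++ n ∷ ys) s∈) n∉s)) e₂)
  where
    n∉s : ¬ (n ∈ s)
    n∉s n∈ = <⇒≱ v<n (subst (n ≤_) (≡ᵇ≡true⇒≡ _ _ mx) (maxList-≥ s n∈))

#ΦValues : ℕ → List ℕ → ℕ
#ΦValues n xs = countᵇ (isΦValue xs) (upTo n)

#ΦValues-insertMax : ∀ n xs ys →
                     #ΦValues (suc n) (xs ++ n ∷ ys) ≤ #ΦValues n (xs ++ ys) + χ (isΦValue (xs ++ n ∷ ys) n)
#ΦValues-insertMax n xs ys = begin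
  #ΦValues (suc n) (xs ++ n ∷ ys)
    ≡⟨ cong (countᵇ (isΦValue (xs ++ n ∷ ys))) (sym (upTo-∷ʳ n)) ⟩
  countᵇ (isΦValue (xs ++ n ∷ ys)) (upTo n ∷ʳ n)
    ≡⟨ ∑-++ _ (upTo n) (n ∷ []) ⟩
  countᵇ (isΦValue (xs ++ n ∷ ys)) (upTo n) + (χ (isΦValue (xs ++ n ∷ ys) n) + 0)
    ≤⟨ +-mono-≤ (countᵇ-mono _ _ (upTo n) (λ v v∈ → isΦValue-removeMax xs n ys v (∈-upTo⁻ v∈)))
                (≤-reflexive (+-identityʳ _)) ⟩
  #ΦValues n (xs ++ ys) + χ (isΦValue (xs ++ n ∷ ys) n) ∎
  where open ≤-Reasoning

Cmp : Bool → ℕ → ℕ → Set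
Cmp true x y = x < y
Cmp false x y = y < x

CmpRel : ℕ → List ℕ → ℕ → List ℕ → Set
CmpRel x [] y [] = ⊤
CmpRel x (x' ∷ xs) y (y' ∷ ys) = Cmp (x <ᵇ x') y y' × CmpRel x xs y ys
CmpRel x [] y (_ ∷ _) = ⊥
CmpRel x (_ ∷ _) y [] = ⊥

-- For concrete p and s, CmpOrder p s unfolds to the strict comparisons between the entries
-- of s prescribed by p.
CmpOrder : List ℕ → List ℕ → Set
CmpOrder [] [] = ⊤
CmpOrder (x ∷ xs) (y ∷ ys) = CmpRel x xs y ys × CmpOrder xs ys
CmpOrder [] (_ ∷ _) = ⊥
CmpOrder (_ ∷ _) [] = ⊥

cmp : ∀ {b y y'} → b ≡ (y <ᵇ y') → y ≢ y' → Cmp b y y'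
cmp {true} {y} {y'} r _ = <ᵇ≡true⇒< y y' (sym r)
cmp {false} {y} {y'} r y≢y' = ≤∧≢⇒< (<ᵇ≡false⇒≥ y y' (sym r)) (y≢y' ∘ sym)

SameRel⇒CmpRel : ∀ x xs y ys → SameRel x xs y ys → ¬ (y ∈ ys) → CmpRel x xs y ys
SameRel⇒CmpRel x [] y [] _ _ = tt
SameRel⇒CmpRel x (x' ∷ xs) y (y' ∷ ys) (r , rs) y∉ =
  cmp r (λ { refl → y∉ (here refl) }) , SameRel⇒CmpRel x xs y ys rs (y∉ ∘ there)

SameOrder⇒CmpOrder : ∀ p s → SameOrder p s → Distinct s → CmpOrder p s
SameOrder⇒CmpOrder [] [] _ _ = tt
SameOrder⇒CmpOrder (x ∷ xs) (y ∷ ys) (r , o) (y∉ ∷ d) = SameRel⇒CmpRel x xs y ys r y∉ , SameOrder⇒CmpOrder xs ys o d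

module _ {xs ys : List ℕ} {n : ℕ} (xs<n : Below n xs) (ys<n : Below n ys) where

  slackAtMax : ∀ pre ys' y → (pre ++ n ∷ (ys' ∷ʳ y)) ⊑ (xs ++ n ∷ ys) → All (_< n) pre →
               Slack pre ys' y → HasSlack xs ys
  slackAtMax pre ys' y q pre<n s
    with pre⊑xs , post⊑ys ← ⊑-split pre (ys' ∷ʳ y) xs n ys q (Below⇒∉ xs<n) (Below⇒∉ ys<n)
                                    (Below⇒∉ (λ _ → lookup pre<n)) =
    ys' , y , post⊑ys , Slack-mono pre⊑xs (⊑-refl ys') s

  OccurrenceGivesSlack : List ℕ → Set
  OccurrenceGivesSlack p = ∀ s → CmpOrder p s → maxList s ≡ n → s ⊑ (xs ++ n ∷ ys) → HasSlack xs ys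

  n≡top : ∀ {s x} → maxList s ≡ n → x ∈ s → All (_≤ x) s → n ≡ x
  n≡top {s} mx x∈ s≤x = trans (sym mx) (maxList-top s x∈ s≤x)

  #above-two : ∀ {y a b} → y < a → y < b → 2 ≤ #above y (a ∷ b ∷ [])
  #above-two y<a y<b rewrite <⇒<ᵇ≡true y<a | <⇒<ᵇ≡true y<b = ≤-refl

  slack-4321 : OccurrenceGivesSlack (4 ∷ 3 ∷ 2 ∷ 1 ∷ [])
  slack-4321 (s₁ ∷ s₂ ∷ s₃ ∷ s₄ ∷ []) ((c₁₂ , c₁₃ , c₁₄ , _) , (c₂₃ , _) , (c₃₄ , _) , _) mx q
    with refl ← n≡top mx (here refl) (≤-refl ∷ <⇒≤ c₁₂ ∷ <⇒≤ c₁₃ ∷ <⇒≤ c₁₄ ∷ []) =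
    slackAtMax [] (s₂ ∷ s₃ ∷ []) s₄ q [] (descentAbove s₂ s₃ (⊑-refl _) c₃₄ c₂₃)

  slack-34512 : OccurrenceGivesSlack (3 ∷ 4 ∷ 5 ∷ 1 ∷ 2 ∷ [])
  slack-34512 (s₁ ∷ s₂ ∷ s₃ ∷ s₄ ∷ s₅ ∷ [])
              ((_ , c₁₃ , _ , c₁₅ , _) , (c₂₃ , _ , c₂₅ , _) , (c₃₄ , c₃₅ , _) , (c₄₅ , _) , _) mx q
    with refl ← n≡top mx (there (there (here refl))) (<⇒≤ c₁₃ ∷ <⇒≤ c₂₃ ∷ ≤-refl ∷ <⇒≤ c₃₄ ∷ <⇒≤ c₃₅ ∷ []) =
    slackAtMax (s₁ ∷ s₂ ∷ []) (s₄ ∷ []) s₅ q (c₁₃ ∷ c₂₃ ∷ [])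
      (twoAboveBelow s₄ (#above-two c₁₅ c₂₅) (here refl) c₄₅)

  slack-43512 : OccurrenceGivesSlack (4 ∷ 3 ∷ 5 ∷ 1 ∷ 2 ∷ [])
  slack-43512 (s₁ ∷ s₂ ∷ s₃ ∷ s₄ ∷ s₅ ∷ [])
              ((_ , c₁₃ , _ , c₁₅ , _) , (c₂₃ , _ , c₂₅ , _) , (c₃₄ , c₃₅ , _) , (c₄₅ , _) , _) mx q
    with refl ← n≡top mx (there (there (here refl))) (<⇒≤ c₁₃ ∷ <⇒≤ c₂₃ ∷ ≤-refl ∷ <⇒≤ c₃₄ ∷ <⇒≤ c₃₅ ∷ []) =
    slackAtMax (s₁ ∷ s₂ ∷ []) (s₄ ∷ []) s₅ q (c₁₃ ∷ c₂₃ ∷ [])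
      (twoAboveBelow s₄ (#above-two c₁₅ c₂₅) (here refl) c₄₅)

  slack-53412 : OccurrenceGivesSlack (5 ∷ 3 ∷ 4 ∷ 1 ∷ 2 ∷ [])
  slack-53412 (s₁ ∷ s₂ ∷ s₃ ∷ s₄ ∷ s₅ ∷ [])
              ((c₁₂ , c₁₃ , c₁₄ , c₁₅ , _) , (_ , _ , c₂₅ , _) , (_ , c₃₅ , _) , (c₄₅ , _) , _) mx q
    with refl ← n≡top mx (here refl) (≤-refl ∷ <⇒≤ c₁₂ ∷ <⇒≤ c₁₃ ∷ <⇒≤ c₁₄ ∷ <⇒≤ c₁₅ ∷ []) =
    slackAtMax [] (s₂ ∷ s₃ ∷ s₄ ∷ []) s₅ q [] (aboveAboveBelow s₂ s₃ s₄ (⊑-refl _) c₂₅ c₃₅ c₄₅)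

  slackAtSecond : ∀ s₁ s₂ s₃ s₄ s₅ → maxList (s₁ ∷ s₂ ∷ s₃ ∷ s₄ ∷ s₅ ∷ []) ≡ n →
                  (s₁ ∷ s₂ ∷ s₃ ∷ s₄ ∷ s₅ ∷ []) ⊑ (xs ++ n ∷ ys) → s₁ < s₂ → s₃ < s₂ → s₄ < s₂ → s₅ < s₂ →
                  Slack (s₁ ∷ []) (s₃ ∷ s₄ ∷ []) s₅ → HasSlack xs ys
  slackAtSecond s₁ s₂ s₃ s₄ s₅ mx q c₁₂ c₃₂ c₄₂ c₅₂ s
    with refl ← n≡top mx (there (here refl)) (<⇒≤ c₁₂ ∷ ≤-refl ∷ <⇒≤ c₃₂ ∷ <⇒≤ c₄₂ ∷ <⇒≤ c₅₂ ∷ []) =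
    slackAtMax (s₁ ∷ []) (s₃ ∷ s₄ ∷ []) s₅ q (c₁₂ ∷ []) s

  slack-45123 : OccurrenceGivesSlack (4 ∷ 5 ∷ 1 ∷ 2 ∷ 3 ∷ [])
  slack-45123 (s₁ ∷ s₂ ∷ s₃ ∷ s₄ ∷ s₅ ∷ []) ((c₁₂ , _ , c₁₄ , c₁₅ , _) , (c₂₃ , c₂₄ , c₂₅ , _) , _) mx q =
    slackAtSecond s₁ s₂ s₃ s₄ s₅ mx q c₁₂ c₂₃ c₂₄ c₂₅ (belowPrefix s₁ s₃ s₄ (here refl) c₁₅ (⊑-refl _) c₁₄)

  slack-45132 : OccurrenceGivesSlack (4 ∷ 5 ∷ 1 ∷ 3 ∷ 2 ∷ [])
  slack-45132 (s₁ ∷ s₂ ∷ s₃ ∷ s₄ ∷ s₅ ∷ []) ((c₁₂ , _ , c₁₄ , c₁₅ , _) , (c₂₃ , c₂₄ , c₂₅ , _) , _) mx q =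
    slackAtSecond s₁ s₂ s₃ s₄ s₅ mx q c₁₂ c₂₃ c₂₄ c₂₅ (belowPrefix s₁ s₃ s₄ (here refl) c₁₅ (⊑-refl _) c₁₄)

  slack-45231 : OccurrenceGivesSlack (4 ∷ 5 ∷ 2 ∷ 3 ∷ 1 ∷ [])
  slack-45231 (s₁ ∷ s₂ ∷ s₃ ∷ s₄ ∷ s₅ ∷ []) ((c₁₂ , _ , c₁₄ , c₁₅ , _) , (c₂₃ , c₂₄ , c₂₅ , _) , _) mx q =
    slackAtSecond s₁ s₂ s₃ s₄ s₅ mx q c₁₂ c₂₃ c₂₄ c₂₅ (belowPrefix s₁ s₃ s₄ (here refl) c₁₅ (⊑-refl _) c₁₄)

  slack-35412 : OccurrenceGivesSlack (3 ∷ 5 ∷ 4 ∷ 1 ∷ 2 ∷ [])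
  slack-35412 (s₁ ∷ s₂ ∷ s₃ ∷ s₄ ∷ s₅ ∷ [])
              ((c₁₂ , _ , _ , c₁₅ , _) , (c₂₃ , c₂₄ , c₂₅ , _) , (c₃₄ , _) , _) mx q =
    slackAtSecond s₁ s₂ s₃ s₄ s₅ mx q c₁₂ c₂₃ c₂₄ c₂₅
      (descentAfterAbove s₁ s₃ s₄ (here refl) c₁₅ (⊑-refl _) c₃₄)

  slack-45213 : OccurrenceGivesSlack (4 ∷ 5 ∷ 2 ∷ 1 ∷ 3 ∷ [])
  slack-45213 (s₁ ∷ s₂ ∷ s₃ ∷ s₄ ∷ s₅ ∷ [])
              ((c₁₂ , _ , _ , c₁₅ , _) , (c₂₃ , c₂₄ , c₂₅ , _) , (c₃₄ , _) , _) mx q =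
    slackAtSecond s₁ s₂ s₃ s₄ s₅ mx q c₁₂ c₂₃ c₂₄ c₂₅
      (descentAfterAbove s₁ s₃ s₄ (here refl) c₁₅ (⊑-refl _) c₃₄)

  slack-45312 : OccurrenceGivesSlack (4 ∷ 5 ∷ 3 ∷ 1 ∷ 2 ∷ [])
  slack-45312 (s₁ ∷ s₂ ∷ s₃ ∷ s₄ ∷ s₅ ∷ [])
              ((c₁₂ , _ , _ , c₁₅ , _) , (c₂₃ , c₂₄ , c₂₅ , _) , (c₃₄ , _) , _) mx q =
    slackAtSecond s₁ s₂ s₃ s₄ s₅ mx q c₁₂ c₂₃ c₂₄ c₂₅
      (descentAfterAbove s₁ s₃ s₄ (here refl) c₁₅ (⊑-refl _) c₃₄)

  Φ-occurrence⇒HasSlack : ∀ {p} → p ∈ Φ → OccurrenceGivesSlack p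
  Φ-occurrence⇒HasSlack (here refl) = slack-4321
  Φ-occurrence⇒HasSlack (there (here refl)) = slack-34512
  Φ-occurrence⇒HasSlack (there (there (here refl))) = slack-45123
  Φ-occurrence⇒HasSlack (there (there (there (here refl)))) = slack-35412
  Φ-occurrence⇒HasSlack (there (there (there (there (here refl))))) = slack-43512
  Φ-occurrence⇒HasSlack (there (there (there (there (there (here refl)))))) = slack-45132
  Φ-occurrence⇒HasSlack (there (there (there (there (there (there (here refl))))))) = slack-45213
  Φ-occurrence⇒HasSlack (there (there (there (there (there (there (there (here refl)))))))) = slack-53412
  Φ-occurrence⇒HasSlack (there (there (there (there (there (there (there (there (here refl))))))))) = slack-45312
  Φ-occurrence⇒HasSlack (there (there (there (there (there (there (there (there (there (here refl)))))))))) = slack-45231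

  isΦValue-max⇒HasSlack : Distinct (xs ++ n ∷ ys) → isΦValue (xs ++ n ∷ ys) n ≡ true → HasSlack xs ys
  isΦValue-max⇒HasSlack d e
    with p , p∈ , e₁ ← any-elim (λ p → any (occursWithMax p n) (subseqs (xs ++ n ∷ ys))) Φ e
    with s , s∈ , e₂ ← any-elim (occursWithMax p n) (subseqs (xs ++ n ∷ ys)) e₁
    with o , mx ← ∧-true {sameOrder p s} e₂ =
    Φ-occurrence⇒HasSlack p∈ s (SameOrder⇒CmpOrder p s (sameOrder⇒SameOrder p s o) (Distinct-resp-⊑ q d))
                          (≡ᵇ≡true⇒≡ _ _ mx) q
    where q = ∈subseqs⇒⊑ (xs ++ n ∷ ys) s∈

IsPermList : ℕ → List ℕ → Set
IsPermList n xs = Distinct xs × Below n xs × length xs ≡ n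

data MaxDecomposition (n : ℕ) : List ℕ → Set where
  split : ∀ xs ys → Below n xs → Below n ys → Distinct (xs ++ n ∷ ys) → IsPermList n (xs ++ ys) →
          MaxDecomposition n (xs ++ n ∷ ys)

max∈ : ∀ n xs → IsPermList (suc n) xs → n ∈ xs
max∈ n xs (d , xs<1+n , len) with n ∈? xs
... | yes n∈ = n∈
... | no n∉ = ⊥-elim (<-irrefl len (begin-strict
      length xs      ≡⟨ sym (∑-one xs) ⟩
      countᵇ (λ _ → true) xs ≤⟨ Distinct⇒countᵇ-≤ (λ _ → true) d (λ x x∈ _ → ∈-upTo⁺ (below x x∈)) ⟩
      length (upTo n) ≡⟨ length-upTo n ⟩
      n              <⟨ ≤-refl ⟩
      suc n          ∎))
  where
    open ≤-Reasoning
    below : Below n xs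
    below x x∈ = ≤∧≢⇒< (≤-pred (xs<1+n x x∈)) (λ { refl → n∉ x∈ })

maxDecomposition : ∀ n xs → IsPermList (suc n) xs → MaxDecomposition n xs
maxDecomposition n xs p@(d , xs<1+n , len) with ys , zs , refl ← ∈-∃++ (max∈ n xs p)
  with n∉ys , n∉zs , d' ← Distinct-middle ys n zs d =
  split ys zs ys<n zs<n d (d' , ys++zs<n , suc-injective (trans (sym (length-++-∷ ys n zs)) len))
  where
    ys<n : Below n ys
    ys<n x x∈ = ≤∧≢⇒< (≤-pred (xs<1+n x (∈-++⁺ˡ x∈))) (λ { refl → n∉ys x∈ })
    zs<n : Below n zs
    zs<n x x∈ = ≤∧≢⇒< (≤-pred (xs<1+n x (∈-++⁺ʳ ys (there x∈)))) (λ { refl → n∉zs x∈ })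
    ys++zs<n : Below n (ys ++ zs)
    ys++zs<n x x∈ with ∈-++⁻ ys x∈
    ... | inj₁ x∈ys = ys<n x x∈ys
    ... | inj₂ x∈zs = zs<n x x∈zs

crossings+χ≤occurrencesThroughMax : ∀ xs n ys → Below n xs → Below n ys → Distinct (xs ++ n ∷ ys) →
  Distinct (xs ++ ys) → crossings xs ys + χ (isΦValue (xs ++ n ∷ ys) n) ≤ occurrencesThroughMax xs ys
crossings+χ≤occurrencesThroughMax xs n ys xs<n ys<n d d' with isΦValue (xs ++ n ∷ ys) n in e
... | true = subst (_≤ occurrencesThroughMax xs ys) (+-comm 1 (crossings xs ys))
               (crossings<occurrencesThroughMax xs ys (reverseView ys) d' (isΦValue-max⇒HasSlack xs<n ys<n d e))
... | false = subst (_≤ occurrencesThroughMax xs ys) (sym (+-identityʳ (crossings xs ys)))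
                (crossings≤occurrencesThroughMax xs ys (reverseView ys) d')

inversions+#ΦValues≤count+crossings : ∀ n xs → IsPermList n xs →
                                      inversions xs + #ΦValues n xs ≤ count321-3412ᴸ xs + crossings [] xs
inversions+#ΦValues≤count+crossings zero [] _ = z≤n
inversions+#ΦValues≤count+crossings (suc n) xs p with maxDecomposition n xs p
... | split ys zs ys<n zs<n d p'@(d' , _) = begin
  inv L + #ΦValues (suc n) L
    ≤⟨ +-monoʳ-≤ (inv L) (#ΦValues-insertMax n ys zs) ⟩
  inv L + (#ΦValues n L' + φ)
    ≡⟨ cong (_+ (#ΦValues n L' + φ)) (inversions-insertMax ys n zs ys<n zs<n) ⟩
  (inv L' + length zs) + (#ΦValues n L' + φ)
    ≡⟨ interchange (inv L') _ _ _ ⟩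
  (inv L' + #ΦValues n L') + (length zs + φ)
    ≤⟨ +-monoˡ-≤ _ (inversions+#ΦValues≤count+crossings n L' p') ⟩
  (count321-3412ᴸ L' + crossings [] L') + (length zs + φ)
    ≡⟨ regroup (count321-3412ᴸ L') _ _ _ ⟩
  count321-3412ᴸ L' + ((crossings [] L' + length zs) + φ)
    ≡⟨ cong (λ t → count321-3412ᴸ L' + (t + φ)) (sym (crossings-insertMax [] ys n zs (λ _ ()) ys<n zs<n)) ⟩
  count321-3412ᴸ L' + ((crossings [] L + crossings ys zs) + φ)
    ≡⟨ cong (count321-3412ᴸ L' +_) (+-assoc (crossings [] L) _ _) ⟩
  count321-3412ᴸ L' + (crossings [] L + (crossings ys zs + φ))
    ≤⟨ +-monoʳ-≤ (count321-3412ᴸ L') (+-monoʳ-≤ (crossings [] L)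
                                      (crossings+χ≤occurrencesThroughMax ys n zs ys<n zs<n d d')) ⟩
  count321-3412ᴸ L' + (crossings [] L + occurrencesThroughMax ys zs)
    ≡⟨ rotate (count321-3412ᴸ L') _ _ ⟩
  (count321-3412ᴸ L' + occurrencesThroughMax ys zs) + crossings [] L
    ≡⟨ cong (_+ crossings [] L) (sym (count321-3412ᴸ-insertMax ys n zs ys<n zs<n)) ⟩
  count321-3412ᴸ L + crossings [] L ∎
  where
    open ≤-Reasoning
    L = ys ++ n ∷ zs
    L' = ys ++ zs
    inv = inversions
    φ = χ (isΦValue L n)
    regroup : ∀ a b c d → (a + b) + (c + d) ≡ a + ((b + c) + d)
    regroup = solve 4 (λ a b c d → (a :+ b) :+ (c :+ d) := a :+ ((b :+ c) :+ d)) refl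
    rotate : ∀ a b c → a + (b + c) ≡ (a + c) + b
    rotate = solve 3 (λ a b c → a :+ (b :+ c) := (a :+ c) :+ b) refl

-- Words in the simple reflections

srefℕ : ℕ → ℕ → ℕ
srefℕ i x = if x ≡ᵇ i then suc i else (if x ≡ᵇ suc i then i else x)

wordℕ : List ℕ → ℕ → ℕ
wordℕ [] x = x
wordℕ (i ∷ ρ) x = srefℕ i (wordℕ ρ x)

wordℕ-++ : ∀ ρ τ x → wordℕ (ρ ++ τ) x ≡ wordℕ ρ (wordℕ τ x)
wordℕ-++ [] τ x = refl
wordℕ-++ (i ∷ ρ) τ x = cong (srefℕ i) (wordℕ-++ ρ τ x)

srefℕ-fix : ∀ i x → x ≢ i → x ≢ suc i → srefℕ i x ≡ x
srefℕ-fix i x x≢i x≢1+i rewrite ≢⇒≡ᵇ≡false x≢i | ≢⇒≡ᵇ≡false x≢1+i = refl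

srefℕ-i : ∀ i → srefℕ i i ≡ suc i
srefℕ-i i rewrite ≡ᵇ-refl i = refl

srefℕ-1+i : ∀ i → srefℕ i (suc i) ≡ i
srefℕ-1+i i rewrite ≢⇒≡ᵇ≡false (1+n≢n {i}) | ≡ᵇ-refl (suc i) = refl

wordℕ-fix : ∀ ρ x → (∀ i → i ∈ ρ → suc i < x) → wordℕ ρ x ≡ x
wordℕ-fix [] x h = refl
wordℕ-fix (i ∷ ρ) x h rewrite wordℕ-fix ρ x (λ j j∈ → h j (there j∈)) =
  srefℕ-fix i x (λ { refl → <⇒≱ (h i (here refl)) (n≤1+n i) })
                (λ { refl → <-irrefl refl (h i (here refl)) })

-- cycleWord k d = s_{k+d-1} ⋯ s_k moves k to k + d and shifts k+1, …, k+d down by one.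
cycleWord : ℕ → ℕ → List ℕ
cycleWord k zero = []
cycleWord k (suc d) = (k + d) ∷ cycleWord k d

cycleWord-below : ∀ k d x → x < k → wordℕ (cycleWord k d) x ≡ x
cycleWord-below k zero x x<k = refl
cycleWord-below k (suc d) x x<k rewrite cycleWord-below k d x x<k =
  srefℕ-fix (k + d) x (λ { refl → <-irrefl refl (<-≤-trans x<k (m≤m+n k d)) })
                      (λ { refl → <-irrefl refl (<-≤-trans x<k (≤-trans (m≤m+n k d) (n≤1+n _))) })

cycleWord-above : ∀ k d x → k + d < x → wordℕ (cycleWord k d) x ≡ x
cycleWord-above k zero x h = refl
cycleWord-above k (suc d) x h rewrite +-suc k d | cycleWord-above k d x (<-trans (n<1+n (k + d)) h) =
  srefℕ-fix (k + d) x (λ { refl → <-asym h (n<1+n x) }) (λ { refl → <-irrefl refl h })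

cycleWord-start : ∀ k d → wordℕ (cycleWord k d) k ≡ k + d
cycleWord-start k zero = sym (+-identityʳ k)
cycleWord-start k (suc d) rewrite cycleWord-start k d | srefℕ-i (k + d) = sym (+-suc k d)

cycleWord-shift : ∀ k d x → k ≤ x → x < k + d → wordℕ (cycleWord k d) (suc x) ≡ x
cycleWord-shift k zero x k≤x x<k+0 = ⊥-elim (<⇒≱ x<k+0 (subst (_≤ x) (sym (+-identityʳ k)) k≤x))
cycleWord-shift k (suc d) x k≤x x<k+1+d with m<1+n⇒m<n∨m≡n (subst (x <_) (+-suc k d) x<k+1+d)
... | inj₁ x<k+d rewrite cycleWord-shift k d x k≤x x<k+d =
  srefℕ-fix (k + d) x (λ { refl → <-irrefl refl x<k+d }) (λ { refl → <-asym x<k+d (n<1+n _) })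
... | inj₂ refl rewrite cycleWord-above k d (suc (k + d)) (n<1+n (k + d)) = srefℕ-1+i (k + d)

cycleWord-letters : ∀ k d i → i ∈ cycleWord k d → i < k + d
cycleWord-letters k (suc d) i (here refl) = subst (k + d <_) (sym (+-suc k d)) (n<1+n (k + d))
cycleWord-letters k (suc d) i (there i∈) = <-trans (cycleWord-letters k d i i∈) (subst (k + d <_) (sym (+-suc k d)) (n<1+n (k + d)))

length-cycleWord : ∀ k d → length (cycleWord k d) ≡ d
length-cycleWord k zero = refl
length-cycleWord k (suc d) = cong suc (length-cycleWord k d)

nth : List ℕ → ℕ → ℕ
nth [] _ = 0
nth (x ∷ xs) zero = x
nth (x ∷ xs) (suc i) = nth xs i

nth-++ˡ : ∀ xs ys i → i < length xs → nth (xs ++ ys) i ≡ nth xs i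
nth-++ˡ (x ∷ xs) ys zero _ = refl
nth-++ˡ (x ∷ xs) ys (suc i) i< = nth-++ˡ xs ys i (≤-pred i<)

nth-++ʳ : ∀ xs ys j → nth (xs ++ ys) (length xs + j) ≡ nth ys j
nth-++ʳ [] ys j = refl
nth-++ʳ (x ∷ xs) ys j = nth-++ʳ xs ys j

Realizes : ℕ → List ℕ → List ℕ → Set
Realizes n xs ρ = (∀ x → x < n → wordℕ ρ x ≡ nth xs x) × (∀ i → i ∈ ρ → suc i < n)

realizes-insertMax : ∀ n xs ys ρ → length xs + length ys ≡ n → Realizes n (xs ++ ys) ρ →
                     Realizes (suc n) (xs ++ n ∷ ys) (ρ ++ cycleWord (length xs) (length ys))
realizes-insertMax n xs ys ρ k+d≡n (ρ-acts , ρ-letters) = acts , letters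
  where
    k = length xs
    d = length ys
    acts : ∀ x → x < suc n → wordℕ (ρ ++ cycleWord k d) x ≡ nth (xs ++ n ∷ ys) x
    acts x x<1+n with <-cmp x k
    ... | tri< x<k _ _ rewrite wordℕ-++ ρ (cycleWord k d) x | cycleWord-below k d x x<k
          | ρ-acts x (<-≤-trans x<k (subst (k ≤_) k+d≡n (m≤m+n k d))) | nth-++ˡ xs ys x x<k = sym (nth-++ˡ xs (n ∷ ys) x x<k)
    ... | tri≈ _ refl _ rewrite wordℕ-++ ρ (cycleWord k d) k | cycleWord-start k d | k+d≡n | wordℕ-fix ρ n ρ-letters =
          sym (trans (cong (nth (xs ++ n ∷ ys)) (sym (+-identityʳ k))) (nth-++ʳ xs (n ∷ ys) 0))
    ... | tri> _ _ k<x with suc x' ← x rewrite wordℕ-++ ρ (cycleWord k d) (suc x')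
          | cycleWord-shift k d x' (≤-pred k<x) (subst (x' <_) (sym k+d≡n) (≤-pred x<1+n)) | ρ-acts x' (≤-pred x<1+n) = begin
      nth (xs ++ ys) x'                 ≡⟨ cong (nth (xs ++ ys)) (sym x'≡k+j) ⟩
      nth (xs ++ ys) (k + j)            ≡⟨ nth-++ʳ xs ys j ⟩
      nth ys j                          ≡⟨ sym (nth-++ʳ xs (n ∷ ys) (suc j)) ⟩
      nth (xs ++ n ∷ ys) (k + suc j)    ≡⟨ cong (nth (xs ++ n ∷ ys)) (trans (+-suc k j) (cong suc x'≡k+j)) ⟩
      nth (xs ++ n ∷ ys) (suc x')       ∎
      where
        open ≡-Reasoning
        j = x' ∸ k
        x'≡k+j : k + j ≡ x'
        x'≡k+j = m+[n∸m]≡n (≤-pred k<x)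
    letters : ∀ i → i ∈ (ρ ++ cycleWord k d) → suc i < suc n
    letters i i∈ with ∈-++⁻ ρ i∈
    ... | inj₁ i∈ρ = <-trans (ρ-letters i i∈ρ) (n<1+n n)
    ... | inj₂ i∈c = s≤s (subst (i <_) k+d≡n (cycleWord-letters k d i i∈c))

bubbleWord : ∀ n xs → IsPermList n xs → Σ (List ℕ) λ ρ → Realizes n xs ρ × length ρ ≡ inversions xs
bubbleWord zero [] _ = [] , ((λ _ ()) , (λ _ ())) , refl
bubbleWord (suc n) xs p with maxDecomposition n xs p
... | split ys zs ys<n zs<n _ p'@(_ , _ , len) with ρ , r , ℓ≡ ← bubbleWord n (ys ++ zs) p' =
  ρ ++ cycleWord (length ys) (length zs) ,
  realizes-insertMax n ys zs ρ (trans (sym (length-++ ys)) len) r ,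
  (begin
    length (ρ ++ cycleWord (length ys) (length zs))    ≡⟨ length-++ ρ ⟩
    length ρ + length (cycleWord (length ys) (length zs)) ≡⟨ cong₂ _+_ ℓ≡ (length-cycleWord (length ys) (length zs)) ⟩
    inversions (ys ++ zs) + length zs                  ≡⟨ sym (inversions-insertMax ys n zs ys<n zs<n) ⟩
    inversions (ys ++ n ∷ zs)                          ∎)
  where open ≡-Reasoning

srefℕ-preserves : ∀ i j x → i ≢ j → (x ≤ j → srefℕ i x ≤ j) × (j < x → j < srefℕ i x)
srefℕ-preserves i j x i≢j with x ≟ i
... | yes refl rewrite srefℕ-i x = (λ x≤j → ≤∧≢⇒< x≤j i≢j) , (λ j<x → m<n⇒m<1+n j<x)
... | no x≢i with x ≟ suc i
...   | yes refl rewrite srefℕ-1+i i = <⇒≤ , (λ j<1+i → ≤∧≢⇒< (≤-pred j<1+i) (λ j≡i → i≢j (sym j≡i)))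
...   | no x≢1+i rewrite srefℕ-fix i x x≢i x≢1+i = (λ h → h) , (λ h → h)

wordℕ-preserves : ∀ ρ j x → ¬ (j ∈ ρ) → (x ≤ j → wordℕ ρ x ≤ j) × (j < x → j < wordℕ ρ x)
wordℕ-preserves [] j x j∉ = (λ h → h) , (λ h → h)
wordℕ-preserves (i ∷ ρ) j x j∉
  with below , above ← wordℕ-preserves ρ j x (λ j∈ → j∉ (there j∈))
     | below′ , above′ ← srefℕ-preserves i j (wordℕ ρ x) (λ { refl → j∉ (here refl) }) =
  (λ x≤j → below′ (below x≤j)) , (λ j<x → above′ (above j<x))

crossings-≤-letters : ∀ ρ ps qs → (∀ p q → p ∈ ps → q ∈ qs → p < q) → AllPairs _<_ qs →
  crossings (map (wordℕ ρ) ps) (map (wordℕ ρ) qs) ≤ countᵇ (λ j → does (j ∈? ρ)) qs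
crossings-≤-letters ρ ps [] _ _ = z≤n
crossings-≤-letters ρ ps (q ∷ qs) ps<qs (q<qs ∷ sorted) =
  +-mono-≤ cut (subst (λ xs → crossings xs (map g qs) ≤ _) (map-++ g ps (q ∷ []))
                  (crossings-≤-letters ρ (ps ∷ʳ q) qs ps∷q<qs sorted))
  where
    g = wordℕ ρ
    ps∷q<qs : ∀ p q' → p ∈ (ps ∷ʳ q) → q' ∈ qs → p < q'
    ps∷q<qs p q' p∈ q'∈ with ∈-++⁻ ps p∈
    ... | inj₁ p∈ps = ps<qs p q' p∈ps (there q'∈)
    ... | inj₂ (here refl) = lookup q<qs q'∈
    p≤q : ∀ {p} → p ∈ (ps ∷ʳ q) → p ≤ q
    p≤q {p} p∈ with ∈-++⁻ ps p∈
    ... | inj₁ p∈ps = <⇒≤ (ps<qs p q p∈ps (here refl))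
    ... | inj₂ (here refl) = ≤-refl
    cut : χ (crosses (map g ps ∷ʳ g q) (map g qs)) ≤ χ (does (q ∈? ρ))
    cut with q ∈? ρ
    ... | yes _ = χ≤1 _
    ... | no q∉ρ = ≤-reflexive (cong χ (≢true⇒≡false λ c →
      let a , a∈ , e₁ = any-elim _ (map g ps ∷ʳ g q) c
          z , z∈ , e₂ = any-elim _ (map g qs) e₁
          p , p∈ , a≡ = ∈-map⁻ g (subst (a ∈_) (sym (map-++ g ps (q ∷ []))) a∈)
          q' , q'∈ , z≡ = ∈-map⁻ g z∈
          a≤q = subst (_≤ q) (sym a≡) (proj₁ (wordℕ-preserves ρ q p q∉ρ) (p≤q p∈))
          q<z = subst (q <_) (sym z≡) (proj₂ (wordℕ-preserves ρ q q' q∉ρ) (lookup q<qs q'∈))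
      in <-irrefl refl (<-trans (<-≤-trans (<ᵇ≡true⇒< z a e₂) a≤q) q<z)))

toℕ-sref : ∀ {m} (i : Fin m) x → toℕ (sref i x) ≡ srefℕ (toℕ i) (toℕ x)
toℕ-sref i x with x Fin.≟ inject₁ i
... | yes refl rewrite toℕ-inject₁ i | ≡ᵇ-refl (toℕ i) = refl
... | no x≢i with x Fin.≟ fsuc i
...   | yes refl rewrite ≢⇒≡ᵇ≡false (1+n≢n {toℕ i}) | ≡ᵇ-refl (suc (toℕ i)) = toℕ-inject₁ i
...   | no x≢1+i rewrite ≢⇒≡ᵇ≡false {toℕ x} {toℕ i} (λ e → x≢i (toℕ-injective (trans e (sym (toℕ-inject₁ i)))))
                 | ≢⇒≡ᵇ≡false {toℕ x} {suc (toℕ i)} (λ e → x≢1+i (toℕ-injective e)) = refl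

toℕ-wordFun : ∀ {m} (ρ : List (Fin m)) x → toℕ (wordFun ρ x) ≡ wordℕ (map toℕ ρ) (toℕ x)
toℕ-wordFun [] x = refl
toℕ-wordFun (i ∷ ρ) x rewrite toℕ-sref i (wordFun ρ x) | toℕ-wordFun ρ x = refl

toFin : ∀ m (ρ : List ℕ) → (∀ i → i ∈ ρ → i < m) → List (Fin m)
toFin m [] _ = []
toFin m (i ∷ ρ) ρ<m = fromℕ< (ρ<m i (here refl)) ∷ toFin m ρ (λ j j∈ → ρ<m j (there j∈))

map-toℕ-toFin : ∀ m ρ ρ<m → map toℕ (toFin m ρ ρ<m) ≡ ρ
map-toℕ-toFin m [] _ = refl
map-toℕ-toFin m (i ∷ ρ) ρ<m = cong₂ _∷_ (toℕ-fromℕ< (ρ<m i (here refl))) (map-toℕ-toFin m ρ (λ j j∈ → ρ<m j (there j∈)))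

length-toFin : ∀ m ρ ρ<m → length (toFin m ρ ρ<m) ≡ length ρ
length-toFin m [] _ = refl
length-toFin m (i ∷ ρ) ρ<m = cong suc (length-toFin m ρ (λ j j∈ → ρ<m j (there j∈)))

tabulate-toℕ : ∀ {A : Set} n (f : ℕ → A) → tabulate (λ i → f (toℕ {n} i)) ≡ applyUpTo f n
tabulate-toℕ zero f = refl
tabulate-toℕ (suc n) f = cong (f 0 ∷_) (tabulate-toℕ n (f ∘ suc))

map-toℕ-allFin : ∀ n → map toℕ (allFin n) ≡ upTo n
map-toℕ-allFin n = trans (map-tabulate id toℕ) (tabulate-toℕ n id)

nth-tabulate : ∀ {n} (h : Fin n → ℕ) x → nth (tabulate h) (toℕ x) ≡ h x
nth-tabulate h fzero = refl
nth-tabulate h (fsuc x) = nth-tabulate (h ∘ fsuc) x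

Distinct-tabulate : ∀ {A : Set} {n} (h : Fin n → A) → (∀ {i j} → h i ≡ h j → i ≡ j) → Distinct (tabulate h)
Distinct-tabulate {n = zero} h inj = []
Distinct-tabulate {n = suc n} h inj =
  (λ h0∈ → let i , e = ∈-tabulate⁻ h0∈ in fzero≢fsuc (inj e)) ∷ Distinct-tabulate (h ∘ fsuc) (fsuc-injective ∘ inj)

oneLine : ∀ {n} → Permutation′ n → List ℕ
oneLine {n} w = map (λ i → toℕ (w ⟨$⟩ʳ i)) (allFin n)

oneLine≡tabulate : ∀ {n} (w : Permutation′ n) → oneLine w ≡ tabulate (λ i → toℕ (w ⟨$⟩ʳ i))
oneLine≡tabulate w = map-tabulate id (λ i → toℕ (w ⟨$⟩ʳ i))

oneLine-IsPermList : ∀ {n} (w : Permutation′ n) → IsPermList n (oneLine w)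
oneLine-IsPermList {n} w rewrite oneLine≡tabulate w =
  Distinct-tabulate _ (λ e → trans (sym (inverseˡ w)) (trans (cong (w ⟨$⟩ˡ_) (toℕ-injective e)) (inverseˡ w))) ,
  (λ v v∈ → let i , v≡ = ∈-tabulate⁻ v∈ in subst (_< n) (sym v≡) (toℕ<n _)) ,
  length-tabulate _

subseqs-map : ∀ {A B : Set} (f : A → B) xs → subseqs (map f xs) ≡ map (map f) (subseqs xs)
subseqs-map f [] = refl
subseqs-map f (x ∷ xs) rewrite subseqs-map f xs | map-++ (map f) (map (x ∷_) (subseqs xs)) (subseqs xs) =
  cong (_++ map (map f) (subseqs xs)) (trans (sym (map-∘ (subseqs xs))) (map-∘ (subseqs xs)))

count≡countPattern : ∀ {n} (w : Permutation′ n) p → count w p ≡ countPattern p (oneLine w)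
count≡countPattern {n} w p = begin
  count w p
    ≡⟨ length-filterᵇ _ (subseqs (allFin n)) ⟩
  countᵇ (λ is → sameOrder p (valuesAt w is)) (subseqs (allFin n))
    ≡⟨ sym (∑-map _ (valuesAt w) (subseqs (allFin n))) ⟩
  countᵇ (sameOrder p) (map (valuesAt w) (subseqs (allFin n)))
    ≡⟨ cong (countᵇ (sameOrder p)) (sym (subseqs-map _ (allFin n))) ⟩
  countPattern p (oneLine w) ∎
  where open ≡-Reasoning

any-filterᵇ : ∀ {A : Set} (p q : A → Bool) xs → any q (filterᵇ p xs) ≡ any (λ x → p x ∧ q x) xs
any-filterᵇ p q [] = refl
any-filterᵇ p q (x ∷ xs) with p x
... | true = cong (q x ∨_) (any-filterᵇ p q xs)
... | false = any-filterᵇ p q xs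

hasROcc≡ : ∀ {n} (w : Permutation′ n) p r → hasROcc w p r ≡ any (occursWithMax p (toℕ r)) (subseqs (oneLine w))
hasROcc≡ {n} w p r = begin
  hasROcc w p r
    ≡⟨ any-filterᵇ _ _ (subseqs (allFin n)) ⟩
  any (λ is → occursWithMax p (toℕ r) (valuesAt w is)) (subseqs (allFin n))
    ≡⟨ sym (any-map (occursWithMax p (toℕ r)) (valuesAt w) (subseqs (allFin n))) ⟩
  any (occursWithMax p (toℕ r)) (map (valuesAt w) (subseqs (allFin n)))
    ≡⟨ cong (any (occursWithMax p (toℕ r))) (sym (subseqs-map _ (allFin n))) ⟩
  any (occursWithMax p (toℕ r)) (subseqs (oneLine w)) ∎
  where open ≡-Reasoning

length-ΦValues : ∀ {n} (w : Permutation′ n) → length (ΦValues w) ≡ #ΦValues n (oneLine w)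
length-ΦValues {n} w = begin
  length (ΦValues w)
    ≡⟨ length-filterᵇ _ (allFin n) ⟩
  countᵇ (λ r → any (λ p → hasROcc w p r) Φ) (allFin n)
    ≡⟨ countᵇ-cong _ _ (allFin n) (λ r _ → any-cong _ _ Φ (λ p → hasROcc≡ w p r)) ⟩
  countᵇ (λ r → isΦValue (oneLine w) (toℕ r)) (allFin n)
    ≡⟨ sym (∑-map _ toℕ (allFin n)) ⟩
  countᵇ (isΦValue (oneLine w)) (map toℕ (allFin n))
    ≡⟨ cong (countᵇ (isΦValue (oneLine w))) (map-toℕ-allFin n) ⟩
  #ΦValues n (oneLine w) ∎
  where open ≡-Reasoning

oneLine≡map-wordℕ : ∀ {m} (w : Permutation′ (suc m)) ρ → IsWordFor w ρ →
                    oneLine w ≡ map (wordℕ (map toℕ ρ)) (upTo (suc m))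
oneLine≡map-wordℕ {m} w ρ isW = begin
  oneLine w
    ≡⟨ map-cong (λ i → trans (cong toℕ (sym (isW i))) (toℕ-wordFun ρ i)) (allFin (suc m)) ⟩
  map (wordℕ (map toℕ ρ) ∘ toℕ) (allFin (suc m))
    ≡⟨ map-∘ (allFin (suc m)) ⟩
  map (wordℕ (map toℕ ρ)) (map toℕ (allFin (suc m)))
    ≡⟨ cong (map (wordℕ (map toℕ ρ))) (map-toℕ-allFin (suc m)) ⟩
  map (wordℕ (map toℕ ρ)) (upTo (suc m)) ∎
  where open ≡-Reasoning

crossings≤|supp| : ∀ {m} (w : Permutation′ (suc m)) ρ → IsWordFor w ρ → crossings [] (oneLine w) ≤ length (supp ρ)
crossings≤|supp| {m} w ρ isW = subst (λ l → crossings [] l ≤ length (supp ρ)) (sym (oneLine≡map-wordℕ w ρ isW))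
  (begin
  crossings [] (map (wordℕ ρℕ) (upTo (suc m)))
    ≤⟨ crossings-≤-letters ρℕ [] (upTo (suc m)) (λ _ _ ()) (applyUpTo⁺₁ id (suc m) (λ i<j _ → i<j)) ⟩
  countᵇ (λ j → does (j ∈? ρℕ)) (upTo (suc m))
    ≤⟨ Distinct⇒countᵇ-≤ _ Distinct-upTo letter∈supp ⟩
  length (map toℕ (supp ρ))
    ≡⟨ length-map toℕ (supp ρ) ⟩
  length (supp ρ) ∎)
  where
    open ≤-Reasoning
    ρℕ = map toℕ ρ
    Distinct-upTo : Distinct (upTo (suc m))
    Distinct-upTo = subst Distinct (tabulate-toℕ (suc m) id) (Distinct-tabulate toℕ toℕ-injective)
    letter∈supp : ∀ j → j ∈ upTo (suc m) → does (j ∈? ρℕ) ≡ true → j ∈ map toℕ (supp ρ)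
    letter∈supp j _ e with j ∈? ρℕ
    ... | yes j∈ with i , i∈ , refl ← ∈-map⁻ toℕ j∈ = ∈-map⁺ toℕ (∈-deduplicate⁺ Fin._≟_ i∈)

length≤inversions : ∀ {m} (w : Permutation′ (suc m)) ρ → IsReduced w ρ → length ρ ≤ inversions (oneLine w)
length≤inversions {m} w ρ (_ , minimal)
  with ρ* , (acts , letters) , ℓ* ← bubbleWord (suc m) (oneLine w) (oneLine-IsPermList w) =
  begin
    length ρ                        ≤⟨ minimal ρFin isWord ⟩
    length ρFin                     ≡⟨ length-toFin m ρ* ρ*<m ⟩
    length ρ*                       ≡⟨ ℓ* ⟩
    inversions (oneLine w)          ∎
  where
    open ≤-Reasoning
    ρ*<m : ∀ i → i ∈ ρ* → i < m
    ρ*<m i i∈ = ≤-pred (letters i i∈)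
    ρFin = toFin m ρ* ρ*<m
    isWord : IsWordFor w ρFin
    isWord x = toℕ-injective (begin-equality
      toℕ (wordFun ρFin x)              ≡⟨ toℕ-wordFun ρFin x ⟩
      wordℕ (map toℕ ρFin) (toℕ x)      ≡⟨ cong (λ r → wordℕ r (toℕ x)) (map-toℕ-toFin m ρ* ρ*<m) ⟩
      wordℕ ρ* (toℕ x)                  ≡⟨ acts (toℕ x) (toℕ<n x) ⟩
      nth (oneLine w) (toℕ x)           ≡⟨ cong (λ l → nth l (toℕ x)) (oneLine≡tabulate w) ⟩
      nth (tabulate (λ i → toℕ (w ⟨$⟩ʳ i))) (toℕ x) ≡⟨ nth-tabulate (λ i → toℕ (w ⟨$⟩ʳ i)) x ⟩
      toℕ (w ⟨$⟩ʳ x)                    ∎)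

∸-+-≤ : ∀ {ℓ s i c r t} → ℓ ≤ i → c ≤ s → s ≤ ℓ → i + r ≤ t + c → (ℓ ∸ s) + r ≤ t
∸-+-≤ {ℓ} {s} {i} {c} {r} {t} ℓ≤i c≤s s≤ℓ i+r≤t+c = +-cancelʳ-≤ c _ _ (begin
  (ℓ ∸ s) + r + c   ≤⟨ +-monoˡ-≤ c (+-monoˡ-≤ r (∸-mono ℓ≤i c≤s)) ⟩
  (i ∸ c) + r + c   ≡⟨ +-assoc (i ∸ c) r c ⟩
  (i ∸ c) + (r + c) ≡⟨ cong ((i ∸ c) +_) (+-comm r c) ⟩
  (i ∸ c) + (c + r) ≡⟨ sym (+-assoc (i ∸ c) c r) ⟩
  (i ∸ c) + c + r   ≡⟨ cong (_+ r) (m∸n+n≡m c≤i) ⟩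
  i + r             ≤⟨ i+r≤t+c ⟩
  t + c             ∎)
  where
    open ≤-Reasoning
    c≤i = ≤-trans c≤s (≤-trans s≤ℓ ℓ≤i)

corollary5p3 : (m : ℕ) (w : Permutation′ (suc m)) (ρ : List (Fin m)) → IsReduced w ρ →
    rep ρ + length (ΦValues w) ≤ count321-3412 w
corollary5p3 m w ρ reduced@(isWord , _) =
  subst₂ (λ r t → rep ρ + r ≤ t) (sym (length-ΦValues w))
         (sym (cong₂ _+_ (count≡countPattern w (3 ∷ 2 ∷ 1 ∷ [])) (count≡countPattern w (3 ∷ 4 ∷ 1 ∷ 2 ∷ []))))
    (∸-+-≤ (length≤inversions w ρ reduced) (crossings≤|supp| w ρ isWord) (length-deduplicate Fin._≟_ ρ)
           (inversions+#ΦValues≤count+crossings (suc m) (oneLine w) (oneLine-IsPermList w)))
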